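{- Let $\mathcal{O}=\{O_1,\dots,O_n\}$ be a family of odd cycles in $K_{n+1}$ without any $\mathcal{O}$-rainbow odd cycle, and let $\mathcal{K}=\{O_1,\dots,O_k\}$ with $k<n$. Suppose $Q$ is a subgraph of $\bigcup\mathcal{K}$ with exactly $k+1$ vertices, and $V\subseteq V(Q)$ is such that every pair of vertices in $V$ can be connected by a $\mathcal{K}$-rainbow path of even length in $Q$. Then: (a) No edge of $O_{k+1},\dots,O_n$ has both endpoints in $V$. Moreover, let $\pi$ be the contraction that replaces $V(Q)$ by a single vertex $\bar v$ (removing all edges between contracted vertices), and let $P_{k+1},\dots,P_n$ be subgraphs of $O_{k+1},\dots,O_n$ respectively such that each $P_i$ avoids all vertices of $V(Q)\setminus V$. Let $\bar{\mathcal{P}}=\{\pi(P_{k+1}),\dots,\pi(P_n)\}$. Then: (b) There is no $\bar{\mathcal{P}}$-rainbow odd cycle in $\pi(K_{n+1})$. (c) If $\bar{\mathcal{P}}$ is a pruned cactus of odd cycles, then $\bigcup\bar{\mathcal{P}}$ is spanning in $\pi(K_{n+1})$, and for no $i\in\{k+1,\dots,n\}$ does $O_i\setminus P_i$ contain an edge $uv$ with $u\notin V(Q)\cup V(P_i)$ and $v\in V\cap V(P_i)$.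
   Context: Cycles, paths and subgraphs are regarded as edge sets; $V(\cdot)$ denotes the vertex set spanned by an edge set, and $\bigcup\mathcal{K}$ the union of the members of $\mathcal{K}$. A family means a multiset. Given a family $\mathcal{E}$ of edge sets, an $\mathcal{E}$-rainbow set is a set $R\subseteq\bigcup\mathcal{E}$ with an injection $\sigma:R\to\mathcal{E}$ such that $e\in\sigma(e)$ for all $e\in R$. Pruned cactus: a family $\mathcal{O}$ of cycles is a pruned cactus if either all cycles in $\mathcal{O}$ are identical to one cycle on $|\mathcal{O}|+1$ vertices, or $\mathcal{O}$ can be partitioned into two pruned cacti $\mathcal{O}_1,\mathcal{O}_2$ such that $\bigcup\mathcal{O}_1$ and $\bigcup\mathcal{O}_2$ share exactly one vertex. -}

module Defs where

open import Data.Nat as ℕ using (ℕ; zero; suc; _+_; _*_; _≤_; _<_)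
open import Data.Nat.Properties using (_<?_)
open import Data.Fin using (Fin; zero; suc; toℕ; fromℕ; fromℕ<; inject₁; _↑ˡ_; _↑ʳ_)
open import Data.Maybe using (Maybe; just; nothing)
open import Data.Product using (Σ; ∃; ∃-syntax; _×_; _,_)
open import Data.Sum using (_⊎_)
open import Data.Unit using (⊤)
open import Relation.Nullary using (¬_; yes; no)
open import Relation.Binary.PropositionalEquality using (_≡_; _≢_)
open import Function using (_∘_; _⇔_; Injective)
open import Function.Bundles using (_↔_; Inverse)

Even : ℕ → Set
Even L = ∃[ t ] L ≡ 2 * t

Odd : ℕ → Set
Odd L = ∃[ t ] L ≡ suc (2 * t)

-- Edge sets on a vertex type A.  An edge set is a relation E; the
-- (undirected, loopless) edge {u,v} belongs to E iff  Adj E u v.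

EdgeSet : Set → Set₁
EdgeSet A = A → A → Set

module _ {A : Set} where

  Adj : EdgeSet A → A → A → Set
  Adj E u v = u ≢ v × (E u v ⊎ E v u)

  SameEdge : A → A → A → A → Set
  SameEdge u v u' v' = (u ≡ u' × v ≡ v') ⊎ (u ≡ v' × v ≡ u')

  _⊆E_ : EdgeSet A → EdgeSet A → Set
  E ⊆E F = ∀ u v → Adj E u v → Adj F u v

  _≐_ : EdgeSet A → EdgeSet A → Set
  E ≐ F = ∀ u v → Adj E u v ⇔ Adj F u v

  VS : EdgeSet A → A → Set
  VS E u = ∃[ v ] Adj E u v

  ⋃ : ∀ {N} → (Fin N → EdgeSet A) → EdgeSet A
  ⋃ F u v = ∃[ i ] F i u v

  _∖E_ : EdgeSet A → EdgeSet A → EdgeSet A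
  (E ∖E F) u v = Adj E u v × ¬ Adj F u v

csuc : ∀ {L} → Fin L → Fin L
csuc {suc L} i with toℕ i <? L
... | yes p = suc (fromℕ< p)
... | no _  = zero

module _ {A : Set} where

  CycEdge : ∀ {L} → (Fin L → A) → A → A → Set
  CycEdge w u v = ∃[ i ] SameEdge (w i) (w (csuc i)) u v

  IsCycle : EdgeSet A → ℕ → Set
  IsCycle C L = 3 ≤ L × Σ (Fin L → A) λ w →
    Injective _≡_ _≡_ w × (∀ u v → Adj C u v ⇔ CycEdge w u v)

  PathEdge : ∀ {L} → (Fin (suc L) → A) → A → A → Set
  PathEdge {L} w u v = ∃[ i ] SameEdge (w (inject₁ {L} i)) (w (suc i)) u v

  IsPath : EdgeSet A → A → A → ℕ → Set
  IsPath P a b L = Σ (Fin (suc L) → A) λ w →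
    Injective _≡_ _≡_ w × w zero ≡ a × w (fromℕ L) ≡ b ×
    (∀ u v → Adj P u v ⇔ PathEdge w u v)

-- Rainbow sets: R ⊆ ⋃F with an injection σ : R → F (on indices of the
-- family, so that F is a multiset) such that e ∈ σ(e).

record Rainbow {A : Set} {N : ℕ} (F : Fin N → EdgeSet A) (R : EdgeSet A) : Set where
  field
    σ     : ∀ {u v} → Adj R u v → Fin N
    σ-wd  : ∀ {u v u' v'} (p : Adj R u v) (q : Adj R u' v') →
            SameEdge u v u' v' → σ p ≡ σ q
    σ-inj : ∀ {u v u' v'} (p : Adj R u v) (q : Adj R u' v') →
            σ p ≡ σ q → SameEdge u v u' v'
    σ-mem : ∀ {u v} (p : Adj R u v) → Adj (F (σ p)) u v

RainbowOddCycleIn : {A : Set} {N : ℕ} → EdgeSet A → (Fin N → EdgeSet A) → Set₁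
RainbowOddCycleIn {A} G F = ∃[ C ] ∃[ L ] (IsCycle C L × Odd L × C ⊆E G × Rainbow F C)

ShareExactlyOne : {A : Set} → EdgeSet A → EdgeSet A → Set
ShareExactlyOne E F = ∃[ x ] (VS E x × VS F x × (∀ y → VS E y → VS F y → y ≡ x))

data PrunedCactus {A : Set} : (N : ℕ) → (Fin N → EdgeSet A) → Set₁ where
  base  : ∀ {N F} (C : EdgeSet A) → IsCycle C (suc N) → (∀ i → F i ≐ C) →
          PrunedCactus N F
  split : ∀ {N N₁ N₂ F} (σ : Fin (N₁ + N₂) ↔ Fin N) →
          PrunedCactus N₁ (F ∘ Inverse.to σ ∘ (_↑ˡ N₂)) →
          PrunedCactus N₂ (F ∘ Inverse.to σ ∘ (N₁ ↑ʳ_)) →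
          ShareExactlyOne (⋃ (F ∘ Inverse.to σ ∘ (_↑ˡ N₂)))
                          (⋃ (F ∘ Inverse.to σ ∘ (N₁ ↑ʳ_))) →
          PrunedCactus N F

Complete : (A : Set) → EdgeSet A
Complete A u v = ⊤

-- Contraction of the vertex set S ⊆ Fin m to a single vertex v̄ = nothing.
-- Vertices of the contracted graph: nothing (= v̄) and just u for u ∉ S.
module Contraction {m : ℕ} (S : Fin m → Set) where

  ValidV : Maybe (Fin m) → Set
  ValidV nothing  = ⊤
  ValidV (just u) = ¬ S u

  Img : Fin m → Maybe (Fin m) → Set
  Img u x = (S u × x ≡ nothing) ⊎ (¬ S u × x ≡ just u)

  πK : EdgeSet (Maybe (Fin m))
  πK x y = ValidV x × ValidV y

  πE : EdgeSet (Fin m) → EdgeSet (Maybe (Fin m))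
  πE E x y = ∃[ u ] ∃[ v ] (Adj E u v × ¬ (S u × S v) × Img u x × Img v y)

module Submission where

open import Defs
open import Data.Bool using (Bool; true; false; not)
import Data.Bool.Properties as Boolₚ
open import Data.Empty using (⊥; ⊥-elim)
open import Data.Fin as Fin using (Fin; zero; suc; toℕ; fromℕ; fromℕ<; inject₁; _↑ˡ_; _↑ʳ_)
import Data.Fin.Properties as Finₚ
open import Data.Fin.Permutation using (↔⇒≡)
open import Data.Maybe using (Maybe; just; nothing)
import Data.Maybe.Properties as Maybeₚ
open import Data.Nat as ℕ using (ℕ; zero; suc; _+_; _*_; _≤_; _<_; z≤n; s≤s)
import Data.Nat.Properties as ℕₚ
open import Data.Product using (Σ; ∃; ∃-syntax; _×_; _,_; proj₁; proj₂)
open import Data.Sum using (_⊎_; inj₁; inj₂; swap; [_,_]′)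
open import Data.Unit using (⊤; tt)
open import Function using (_∘_; _⇔_; Injective; mk⇔; Equivalence)
open import Function.Bundles using (_↔_; Inverse)
open import Relation.Binary using (DecidableEquality)
open import Relation.Binary.PropositionalEquality
open import Relation.Nullary using (¬_; Dec; yes; no)

-- (a) An edge of O_{k+j} inside V would close an even K-rainbow path of Q into a
-- rainbow odd cycle.  (b) A P̄-rainbow odd cycle either avoids v̄, and then lifts
-- to a rainbow odd cycle of O, or passes through v̄ along edges u₀x and yu₁ with
-- u₀, u₁ ∈ V; replacing v̄ by an even K-rainbow path from u₁ to u₀ inside Q again
-- gives a rainbow odd cycle of O.  (c) By induction on the pruned cactus, any two of
-- its vertices are joined by rainbow paths of both parities, and a vertex outside a
-- member P̄_i is joined to any vertex of P̄_i by an even rainbow path avoiding colour i.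
-- A pruned cactus on N members has N + 1 vertices, as many as π(K_{n+1}) has, so it
-- spans.  An edge uv as in (c) would close the even path from u to v̄ avoiding colour
-- j into a rainbow odd cycle of the contraction of P with uv added to P_j,
-- contradicting (b) for that family.


module _ {A : Set} where

  Adj-sym : ∀ {E : EdgeSet A} {u v} → Adj E u v → Adj E v u
  Adj-sym (u≢v , inj₁ e) = u≢v ∘ sym , inj₂ e
  Adj-sym (u≢v , inj₂ e) = u≢v ∘ sym , inj₁ e

  SameEdge-sym : ∀ {a b c d : A} → SameEdge a b c d → SameEdge c d a b
  SameEdge-sym (inj₁ (p , q)) = inj₁ (sym p , sym q)
  SameEdge-sym (inj₂ (p , q)) = inj₂ (sym q , sym p)

  SameEdge-flipʳ : ∀ {a b c d : A} → SameEdge a b c d → SameEdge a b d c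
  SameEdge-flipʳ = swap

  SameEdge-trans : ∀ {a b c d e f : A} → SameEdge a b c d → SameEdge c d e f → SameEdge a b e f
  SameEdge-trans (inj₁ (refl , refl)) s = s
  SameEdge-trans (inj₂ (refl , refl)) s = SameEdge-sym (SameEdge-flipʳ (SameEdge-sym s))

  Adj-resp-SameEdge : ∀ {E : EdgeSet A} {a b u v} → SameEdge a b u v → Adj E a b → Adj E u v
  Adj-resp-SameEdge (inj₁ (refl , refl)) e = e
  Adj-resp-SameEdge {E} (inj₂ (refl , refl)) e = Adj-sym {E = E} e

  Adj⇒Adj-⋃ : ∀ {N} {F : Fin N → EdgeSet A} i {u v} → Adj (F i) u v → Adj (⋃ F) u v
  Adj⇒Adj-⋃ i (u≢v , inj₁ e) = u≢v , inj₁ (i , e)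
  Adj⇒Adj-⋃ i (u≢v , inj₂ e) = u≢v , inj₂ (i , e)

  Adj-⋃⇒Adj : ∀ {N} {F : Fin N → EdgeSet A} {u v} → Adj (⋃ F) u v → ∃[ i ] Adj (F i) u v
  Adj-⋃⇒Adj (u≢v , inj₁ (i , e)) = i , u≢v , inj₁ e
  Adj-⋃⇒Adj (u≢v , inj₂ (i , e)) = i , u≢v , inj₂ e

↑ˡ≢↑ʳ : ∀ {a b} (c : Fin a) (c' : Fin b) → c ↑ˡ b ≢ a ↑ʳ c'
↑ˡ≢↑ʳ {a} {b} c c' eq
  with () ← trans (sym (Finₚ.splitAt-↑ˡ a c b)) (trans (cong (Fin.splitAt a) eq) (Finₚ.splitAt-↑ʳ a b c'))

data Inject₁OrLast : ∀ {M} → Fin (suc M) → Set where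
  inject : ∀ {M} (j : Fin M) → Inject₁OrLast (inject₁ j)
  last   : ∀ {M} → Inject₁OrLast (fromℕ M)

inject₁OrLast : ∀ {M} (i : Fin (suc M)) → Inject₁OrLast i
inject₁OrLast {zero}  zero    = last
inject₁OrLast {suc M} zero    = inject zero
inject₁OrLast {suc M} (suc i) with inject₁OrLast i
... | inject j = inject (suc j)
... | last     = last

csuc-inject₁ : ∀ {M} (j : Fin M) → csuc (inject₁ j) ≡ suc j
csuc-inject₁ {M} j with toℕ (inject₁ j) ℕₚ.<? M
... | yes p = cong suc (Finₚ.toℕ-injective (trans (Finₚ.toℕ-fromℕ< p) (Finₚ.toℕ-inject₁ j)))
... | no ¬p = ⊥-elim (¬p (subst (_< M) (sym (Finₚ.toℕ-inject₁ j)) (Finₚ.toℕ<n j)))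

csuc-fromℕ : ∀ M → csuc (fromℕ M) ≡ zero
csuc-fromℕ M with toℕ (fromℕ M) ℕₚ.<? M
... | yes p = ⊥-elim (ℕₚ.<-irrefl (Finₚ.toℕ-fromℕ M) p)
... | no _  = refl

toℕ-csuc : ∀ {M} (i : Fin (suc M)) →
           (suc (toℕ i) ≤ M × toℕ (csuc i) ≡ suc (toℕ i)) ⊎ (toℕ i ≡ M × toℕ (csuc i) ≡ 0)
toℕ-csuc i with inject₁OrLast i
... | inject j rewrite csuc-inject₁ j | Finₚ.toℕ-inject₁ j = inj₁ (Finₚ.toℕ<n j , refl)
... | last {M} rewrite csuc-fromℕ M | Finₚ.toℕ-fromℕ M = inj₂ (refl , refl)

csuc-injective : ∀ {M} → Injective _≡_ _≡_ (csuc {suc M})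
csuc-injective {M} {i} {j} eq with toℕ-csuc i | toℕ-csuc j
... | inj₁ (_ , a) | inj₁ (_ , b) =
  Finₚ.toℕ-injective (ℕₚ.suc-injective (trans (sym a) (trans (cong toℕ eq) b)))
... | inj₁ (_ , a) | inj₂ (_ , b) with () ← trans (sym a) (trans (cong toℕ eq) b)
... | inj₂ (_ , a) | inj₁ (_ , b) with () ← trans (sym a) (trans (cong toℕ eq) b)
... | inj₂ (x , _) | inj₂ (y , _) = Finₚ.toℕ-injective (trans x (sym y))

csuc≢id : ∀ {M} → 1 ≤ M → (i : Fin (suc M)) → csuc i ≢ i
csuc≢id (s≤s z≤n) i eq with toℕ-csuc i
... | inj₁ (_ , a) = ℕₚ.1+n≢n (sym (trans (sym (cong toℕ eq)) a))
... | inj₂ (x , a) with () ← trans (sym x) (trans (sym (cong toℕ eq)) a)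

csuc²≢id : ∀ {M} → 2 ≤ M → (i : Fin (suc M)) → csuc (csuc i) ≢ i
csuc²≢id (s≤s (s≤s z≤n)) i eq with toℕ-csuc i | toℕ-csuc (csuc i)
... | inj₁ (_ , a) | inj₁ (_ , b) = ℕₚ.<-irrefl (sym (cong toℕ eq))
  (subst (toℕ i <_) (sym (trans b (cong suc a))) (ℕₚ.<-trans (ℕₚ.n<1+n _) (ℕₚ.n<1+n _)))
... | inj₁ (_ , a) | inj₂ (x , b) with () ← trans (cong suc (trans (sym b) (cong toℕ eq))) (trans (sym a) x)
... | inj₂ (x , a) | inj₁ (_ , b) with () ← trans (sym x) (trans (sym (cong toℕ eq)) (trans b (cong suc a)))
... | inj₂ (x , a) | inj₂ (y , b) with () ← trans (sym y) a

csuc^ : ∀ {M} → ℕ → Fin (suc M) → Fin (suc M)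
csuc^ zero    i = i
csuc^ (suc r) i = csuc (csuc^ r i)

csuc^-csuc : ∀ {M} r (i : Fin (suc M)) → csuc^ r (csuc i) ≡ csuc (csuc^ r i)
csuc^-csuc zero    i = refl
csuc^-csuc (suc r) i = cong csuc (csuc^-csuc r i)

csuc^-injective : ∀ {M} r → Injective _≡_ _≡_ (csuc^ {M} r)
csuc^-injective zero    eq = eq
csuc^-injective (suc r) eq = csuc^-injective r (csuc-injective eq)

csuc-surjective : ∀ {M} (t : Fin (suc M)) → ∃[ u ] csuc u ≡ t
csuc-surjective {M}     zero    = fromℕ M , csuc-fromℕ M
csuc-surjective {suc M} (suc j) = inject₁ j , csuc-inject₁ j

csuc^-surjective : ∀ {M} r (t : Fin (suc M)) → ∃[ u ] csuc^ r u ≡ t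
csuc^-surjective zero    t = t , refl
csuc^-surjective (suc r) t with csuc-surjective t
... | u , csuc-u≡t with csuc^-surjective r u
... | v , eq = v , trans (cong csuc eq) csuc-u≡t

toℕ-csuc^-zero : ∀ {M} r → r ≤ M → toℕ (csuc^ {M} r zero) ≡ r
toℕ-csuc^-zero zero    _ = refl
toℕ-csuc^-zero (suc r) r<M with toℕ-csuc (csuc^ r zero)
... | inj₁ (_ , t) = trans t (cong suc (toℕ-csuc^-zero r (ℕₚ.<⇒≤ r<M)))
... | inj₂ (t , _) = ⊥-elim (ℕₚ.<-irrefl (sym (trans (sym t) (toℕ-csuc^-zero r (ℕₚ.<⇒≤ r<M)))) r<M)

csuc^-toℕ-zero : ∀ {M} (s : Fin (suc M)) → csuc^ (toℕ s) zero ≡ s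
csuc^-toℕ-zero s = Finₚ.toℕ-injective (toℕ-csuc^-zero (toℕ s) (ℕₚ.≤-pred (Finₚ.toℕ<n s)))

isEven : ℕ → Bool
isEven zero    = true
isEven (suc n) = not (isEven n)

xnor : Bool → Bool → Bool
xnor true  b = b
xnor false b = not b

isEven-+ : ∀ m n → isEven (m + n) ≡ xnor (isEven m) (isEven n)
isEven-+ zero    n = refl
isEven-+ (suc m) n rewrite isEven-+ m n with isEven m
... | true  = refl
... | false = Boolₚ.not-involutive (isEven n)

xnor-diag : ∀ b → xnor b b ≡ true
xnor-diag true  = refl
xnor-diag false = refl

xnor-false : ∀ a c b → xnor a c ≡ false → a ≢ b → c ≡ b
xnor-false true  false false _  _   = refl
xnor-false false true  true  _  _   = refl
xnor-false true  false true  _  a≢b = ⊥-elim (a≢b refl)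
xnor-false false true  false _  a≢b = ⊥-elim (a≢b refl)
xnor-false true  true  _     () _
xnor-false false false _     () _

isEven⇒Even : ∀ n → isEven n ≡ true → Even n
isEven⇒Odd  : ∀ n → isEven n ≡ false → Odd n
isEven⇒Even zero    _ = 0 , refl
isEven⇒Even (suc n) h with isEven⇒Odd n (Boolₚ.not-injective h)
... | t , refl = suc t , cong suc (sym (ℕₚ.+-suc t (t + 0)))
isEven⇒Odd  zero    ()
isEven⇒Odd  (suc n) h with isEven⇒Even n (Boolₚ.not-injective h)
... | t , refl = t , refl

isEven-double : ∀ t → isEven (2 * t) ≡ true
isEven-double zero    = refl
isEven-double (suc t) rewrite ℕₚ.+-suc t (t + 0) | isEven-double t = refl

Even⇒isEven : ∀ n → Even n → isEven n ≡ true
Even⇒isEven _ (t , refl) = isEven-double t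

Odd⇒isEven : ∀ n → Odd n → isEven n ≡ false
Odd⇒isEven _ (t , refl) = cong not (isEven-double t)

Odd-+-Even : ∀ {a b} → Odd a → Even b → Odd (a + b)
Odd-+-Even {a} {b} odd-a even-b =
  isEven⇒Odd (a + b) (trans (isEven-+ a b) (cong₂ xnor (Odd⇒isEven a odd-a) (Even⇒isEven b even-b)))

Even⇒Odd-suc : ∀ {L} → Even L → Odd (suc L)
Even⇒Odd-suc (t , eq) = t , cong suc eq

Even⇒≢0⇒≥2 : ∀ {L} → Even L → L ≢ 0 → 2 ≤ L
Even⇒≢0⇒≥2 (zero  , refl) L≢0 = ⊥-elim (L≢0 refl)
Even⇒≢0⇒≥2 (suc t , refl) _   = s≤s (ℕₚ.≤-trans (s≤s z≤n) (ℕₚ.m≤n+m (suc (t + 0)) t))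

data Walk {A : Set} {N : ℕ} (F : Fin N → EdgeSet A) : A → A → Set where
  []   : ∀ {a} → Walk F a a
  step : ∀ {a b z} (c : Fin N) → Adj (F c) a b → Walk F b z → Walk F a z

module _ {A : Set} {N : ℕ} {F : Fin N → EdgeSet A} where

  length : ∀ {a z} → Walk F a z → ℕ
  length []           = 0
  length (step c e p) = suc (length p)

  _∈ᵥ_ : ∀ {a z} → A → Walk F a z → Set
  x ∈ᵥ ([] {a})         = x ≡ a
  x ∈ᵥ (step {a} c e p) = x ≡ a ⊎ x ∈ᵥ p

  _∈ᶜ_ : ∀ {a z} → Fin N → Walk F a z → Set
  c ∈ᶜ []            = ⊥
  c ∈ᶜ (step c' e p) = c ≡ c' ⊎ c ∈ᶜ p

  IsSimple : ∀ {a z} → Walk F a z → Set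
  IsSimple []               = ⊤
  IsSimple (step {a} c e p) = ¬ (a ∈ᵥ p) × IsSimple p

  IsRainbow : ∀ {a z} → Walk F a z → Set
  IsRainbow []           = ⊤
  IsRainbow (step c e p) = ¬ (c ∈ᶜ p) × IsRainbow p

  start∈ᵥ : ∀ {a z} (p : Walk F a z) → a ∈ᵥ p
  start∈ᵥ []           = refl
  start∈ᵥ (step c e p) = inj₁ refl

  end∈ᵥ : ∀ {a z} (p : Walk F a z) → z ∈ᵥ p
  end∈ᵥ []           = refl
  end∈ᵥ (step c e p) = inj₂ (end∈ᵥ p)

  ∈ᵥ⇒VS-⋃ : ∀ {a b z x} c (e : Adj (F c) a b) (p : Walk F b z) → x ∈ᵥ step c e p → VS (⋃ F) x
  ∈ᵥ⇒VS-⋃ c e p            (inj₁ refl)       = _ , Adj⇒Adj-⋃ {F = F} c e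
  ∈ᵥ⇒VS-⋃ c e []           (inj₂ refl)       = _ , Adj⇒Adj-⋃ {F = F} c (Adj-sym {E = F c} e)
  ∈ᵥ⇒VS-⋃ c e (step d f p) (inj₂ x∈)        = ∈ᵥ⇒VS-⋃ d f p x∈

  ∈ᵥ-nonempty⇒VS-⋃ : ∀ {a z x} (p : Walk F a z) → a ≢ z → x ∈ᵥ p → VS (⋃ F) x
  ∈ᵥ-nonempty⇒VS-⋃ []           a≢z _  = ⊥-elim (a≢z refl)
  ∈ᵥ-nonempty⇒VS-⋃ (step c e p) _   x∈ = ∈ᵥ⇒VS-⋃ c e p x∈

  length≡0⇒≡ : ∀ {a z} (p : Walk F a z) → length p ≡ 0 → a ≡ z
  length≡0⇒≡ [] _ = refl

  _++ʷ_ : ∀ {a b z} → Walk F a b → Walk F b z → Walk F a z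
  []           ++ʷ q = q
  step c e p   ++ʷ q = step c e (p ++ʷ q)

  length-++ : ∀ {a b z} (p : Walk F a b) (q : Walk F b z) → length (p ++ʷ q) ≡ length p + length q
  length-++ []           q = refl
  length-++ (step c e p) q = cong suc (length-++ p q)

  ∈ᵥ-++⁻ : ∀ {a b z x} (p : Walk F a b) (q : Walk F b z) → x ∈ᵥ (p ++ʷ q) → x ∈ᵥ p ⊎ x ∈ᵥ q
  ∈ᵥ-++⁻ []           q x∈ = inj₂ x∈
  ∈ᵥ-++⁻ (step c e p) q (inj₁ x≡) = inj₁ (inj₁ x≡)
  ∈ᵥ-++⁻ (step c e p) q (inj₂ x∈) with ∈ᵥ-++⁻ p q x∈
  ... | inj₁ x∈p = inj₁ (inj₂ x∈p)
  ... | inj₂ x∈q = inj₂ x∈q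

  ∈ᶜ-++⁻ : ∀ {a b z c} (p : Walk F a b) (q : Walk F b z) → c ∈ᶜ (p ++ʷ q) → c ∈ᶜ p ⊎ c ∈ᶜ q
  ∈ᶜ-++⁻ []           q c∈ = inj₂ c∈
  ∈ᶜ-++⁻ (step c e p) q (inj₁ c≡) = inj₁ (inj₁ c≡)
  ∈ᶜ-++⁻ (step c e p) q (inj₂ c∈) with ∈ᶜ-++⁻ p q c∈
  ... | inj₁ c∈p = inj₁ (inj₂ c∈p)
  ... | inj₂ c∈q = inj₂ c∈q

  IsSimple-++ : ∀ {a b z} (p : Walk F a b) (q : Walk F b z) → IsSimple p → IsSimple q →
                (∀ x → x ∈ᵥ p → x ∈ᵥ q → x ≡ b) → IsSimple (p ++ʷ q)
  IsSimple-++ []               q _            sq _      = sq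
  IsSimple-++ (step {a} c e p) q (a∉p , sp) sq meet = a∉p++q , IsSimple-++ p q sp sq (λ x → meet x ∘ inj₂)
    where
    a∉p++q : ¬ (a ∈ᵥ (p ++ʷ q))
    a∉p++q a∈ with ∈ᵥ-++⁻ p q a∈
    ... | inj₁ a∈p = a∉p a∈p
    ... | inj₂ a∈q with meet a (inj₁ refl) a∈q
    ... | refl = a∉p (end∈ᵥ p)

  IsRainbow-++ : ∀ {a b z} (p : Walk F a b) (q : Walk F b z) → IsRainbow p → IsRainbow q →
                 (∀ c → c ∈ᶜ p → c ∈ᶜ q → ⊥) → IsRainbow (p ++ʷ q)
  IsRainbow-++ []           q _          rq _        = rq
  IsRainbow-++ (step c e p) q (c∉p , rp) rq disjoint =
    c∉p++q , IsRainbow-++ p q rp rq (λ d → disjoint d ∘ inj₂)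
    where
    c∉p++q : ¬ (c ∈ᶜ (p ++ʷ q))
    c∉p++q c∈ with ∈ᶜ-++⁻ p q c∈
    ... | inj₁ c∈p = c∉p c∈p
    ... | inj₂ c∈q = disjoint c (inj₁ refl) c∈q

  reverse : ∀ {a z} → Walk F a z → Walk F z a
  reverse []           = []
  reverse (step c e p) = reverse p ++ʷ step c (Adj-sym {E = F c} e) []

  length-reverse : ∀ {a z} (p : Walk F a z) → length (reverse p) ≡ length p
  length-reverse []           = refl
  length-reverse (step c e p) =
    trans (length-++ (reverse p) _) (trans (ℕₚ.+-comm (length (reverse p)) 1) (cong suc (length-reverse p)))

  ∈ᵥ-reverse⁻ : ∀ {a z x} (p : Walk F a z) → x ∈ᵥ reverse p → x ∈ᵥ p
  ∈ᵥ-reverse⁻ []           x∈ = x∈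
  ∈ᵥ-reverse⁻ (step c e p) x∈ with ∈ᵥ-++⁻ (reverse p) _ x∈
  ... | inj₁ x∈p         = inj₂ (∈ᵥ-reverse⁻ p x∈p)
  ... | inj₂ (inj₁ refl) = inj₂ (start∈ᵥ p)
  ... | inj₂ (inj₂ refl) = inj₁ refl

  IsSimple-reverse : ∀ {a z} (p : Walk F a z) → IsSimple p → IsSimple (reverse p)
  IsSimple-reverse []           _          = tt
  IsSimple-reverse (step {a} {b} c e p) (a∉p , sp) =
    IsSimple-++ (reverse p) back (IsSimple-reverse p sp) (proj₁ e ∘ sym , tt) meet
    where
    back = step c (Adj-sym {E = F c} e) []
    meet : ∀ x → x ∈ᵥ reverse p → x ∈ᵥ back → x ≡ b
    meet x x∈ (inj₁ refl) = refl
    meet x x∈ (inj₂ refl) = ⊥-elim (a∉p (∈ᵥ-reverse⁻ p x∈))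

  walkAlong : ∀ {L} (W : Fin (suc L) → A) (col : Fin L → Fin N) →
              (∀ i → Adj (F (col i)) (W (inject₁ i)) (W (suc i))) →
              ∀ {a z} → W zero ≡ a → W (fromℕ L) ≡ z → Walk F a z
  walkAlong {zero}  W col edge refl refl = []
  walkAlong {suc L} W col edge refl W-last =
    step (col zero) (edge zero) (walkAlong (W ∘ suc) (col ∘ suc) (edge ∘ suc) refl W-last)

  length-walkAlong : ∀ {L} W col edge {a z} (W₀ : W zero ≡ a) (W-last : W (fromℕ L) ≡ z) →
                     length (walkAlong {L} W col edge W₀ W-last) ≡ L
  length-walkAlong {zero}  W col edge refl refl   = refl
  length-walkAlong {suc L} W col edge refl W-last =
    cong suc (length-walkAlong (W ∘ suc) (col ∘ suc) (edge ∘ suc) refl W-last)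

  ∈ᵥ-walkAlong⁻ : ∀ {L} W col edge {a z x} (W₀ : W zero ≡ a) (W-last : W (fromℕ L) ≡ z) →
                  x ∈ᵥ walkAlong {L} W col edge W₀ W-last → ∃[ i ] W i ≡ x
  ∈ᵥ-walkAlong⁻ {zero}  W col edge refl refl   refl        = zero , refl
  ∈ᵥ-walkAlong⁻ {suc L} W col edge refl W-last (inj₁ refl) = zero , refl
  ∈ᵥ-walkAlong⁻ {suc L} W col edge refl W-last (inj₂ x∈)
    with ∈ᵥ-walkAlong⁻ (W ∘ suc) (col ∘ suc) (edge ∘ suc) refl W-last x∈
  ... | i , eq = suc i , eq

  ∈ᶜ-walkAlong⁻ : ∀ {L} W col edge {a z c} (W₀ : W zero ≡ a) (W-last : W (fromℕ L) ≡ z) →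
                  c ∈ᶜ walkAlong {L} W col edge W₀ W-last → ∃[ i ] col i ≡ c
  ∈ᶜ-walkAlong⁻ {zero}  W col edge refl refl   ()
  ∈ᶜ-walkAlong⁻ {suc L} W col edge refl W-last (inj₁ refl) = zero , refl
  ∈ᶜ-walkAlong⁻ {suc L} W col edge refl W-last (inj₂ c∈)
    with ∈ᶜ-walkAlong⁻ (W ∘ suc) (col ∘ suc) (edge ∘ suc) refl W-last c∈
  ... | i , eq = suc i , eq

  IsSimple-walkAlong : ∀ {L} W col edge {a z} (W₀ : W zero ≡ a) (W-last : W (fromℕ L) ≡ z) →
                       Injective _≡_ _≡_ W → IsSimple (walkAlong {L} W col edge W₀ W-last)
  IsSimple-walkAlong {zero}  W col edge refl refl   _     = tt
  IsSimple-walkAlong {suc L} W col edge refl W-last W-inj =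
    (λ W₀∈ → let (i , eq) = ∈ᵥ-walkAlong⁻ (W ∘ suc) (col ∘ suc) (edge ∘ suc) refl W-last W₀∈
             in Finₚ.0≢1+n (sym (W-inj eq))) ,
    IsSimple-walkAlong (W ∘ suc) (col ∘ suc) (edge ∘ suc) refl W-last (Finₚ.suc-injective ∘ W-inj)

  IsRainbow-walkAlong : ∀ {L} W col edge {a z} (W₀ : W zero ≡ a) (W-last : W (fromℕ L) ≡ z) →
                        Injective _≡_ _≡_ col → IsRainbow (walkAlong {L} W col edge W₀ W-last)
  IsRainbow-walkAlong {zero}  W col edge refl refl   _       = tt
  IsRainbow-walkAlong {suc L} W col edge refl W-last col-inj =
    (λ c∈ → let (i , eq) = ∈ᶜ-walkAlong⁻ (W ∘ suc) (col ∘ suc) (edge ∘ suc) refl W-last c∈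
            in Finₚ.0≢1+n (sym (col-inj eq))) ,
    IsRainbow-walkAlong (W ∘ suc) (col ∘ suc) (edge ∘ suc) refl W-last (Finₚ.suc-injective ∘ col-inj)

module _ {A : Set} {N : ℕ} {F : Fin N → EdgeSet A} where

  IsPath⇒Walk : ∀ {P : EdgeSet A} {a b L} → IsPath P a b L → Rainbow F P →
    Σ (Walk F a b) λ p → IsSimple p × IsRainbow p × length p ≡ L × (∀ x → x ∈ᵥ p → VS P x ⊎ x ≡ b)
  IsPath⇒Walk {P} {L = L} (w , w-inj , w₀ , w-last , P⇔) rainbow =
    walkAlong w colour member w₀ w-last ,
    IsSimple-walkAlong w colour member w₀ w-last w-inj ,
    IsRainbow-walkAlong w colour member w₀ w-last colour-inj ,
    length-walkAlong w colour member w₀ w-last ,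
    on-path
    where
    open Rainbow rainbow
    edgeAt : ∀ i → Adj P (w (inject₁ i)) (w (suc i))
    edgeAt i = Equivalence.from (P⇔ _ _) (i , inj₁ (refl , refl))
    colour : Fin L → Fin N
    colour = σ ∘ edgeAt
    member : ∀ i → Adj (F (colour i)) (w (inject₁ i)) (w (suc i))
    member = σ-mem ∘ edgeAt
    colour-inj : Injective _≡_ _≡_ colour
    colour-inj {i} {i'} eq with σ-inj (edgeAt i) (edgeAt i') eq
    ... | inj₁ (w≡ , _) = Finₚ.inject₁-injective (w-inj w≡)
    ... | inj₂ (w≡ , w≡') = ⊥-elim (ℕₚ.<-irrefl refl (ℕₚ.<-trans (ℕₚ.n<1+n (toℕ i)) i+1<i))
      where
      i≡i'+1 : toℕ i ≡ suc (toℕ i')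
      i≡i'+1 = trans (sym (Finₚ.toℕ-inject₁ i)) (cong toℕ (w-inj w≡))
      i+1≡i' : suc (toℕ i) ≡ toℕ i'
      i+1≡i' = trans (cong toℕ (w-inj w≡')) (Finₚ.toℕ-inject₁ i')
      i+1<i : suc (toℕ i) < toℕ i
      i+1<i = subst (_< toℕ i) (sym i+1≡i') (subst (toℕ i' <_) (sym i≡i'+1) (ℕₚ.n<1+n (toℕ i')))
    on-path : ∀ x → x ∈ᵥ walkAlong w colour member w₀ w-last → VS P x ⊎ x ≡ _
    on-path x x∈ with ∈ᵥ-walkAlong⁻ w colour member w₀ w-last x∈
    ... | i , refl with inject₁OrLast i
    ... | inject j = inj₁ (_ , edgeAt j)
    ... | last     = inj₂ w-last

module _ {A : Set} {N M : ℕ} {F : Fin N → EdgeSet A} {G : Fin M → EdgeSet A}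
         (h : Fin N → Fin M) (h-edge : ∀ c {u v} → Adj (F c) u v → Adj (G (h c)) u v) where

  reindex : ∀ {a z} → Walk F a z → Walk G a z
  reindex []           = []
  reindex (step c e p) = step (h c) (h-edge c e) (reindex p)

  length-reindex : ∀ {a z} (p : Walk F a z) → length (reindex p) ≡ length p
  length-reindex []           = refl
  length-reindex (step c e p) = cong suc (length-reindex p)

  ∈ᵥ-reindex⁻ : ∀ {a z x} (p : Walk F a z) → x ∈ᵥ reindex p → x ∈ᵥ p
  ∈ᵥ-reindex⁻ []           x∈        = x∈
  ∈ᵥ-reindex⁻ (step c e p) (inj₁ x≡) = inj₁ x≡
  ∈ᵥ-reindex⁻ (step c e p) (inj₂ x∈) = inj₂ (∈ᵥ-reindex⁻ p x∈)

  ∈ᶜ-reindex⁻ : ∀ {a z c} (p : Walk F a z) → c ∈ᶜ reindex p → ∃[ c' ] (c' ∈ᶜ p × h c' ≡ c)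
  ∈ᶜ-reindex⁻ (step c e p) (inj₁ refl) = c , inj₁ refl , refl
  ∈ᶜ-reindex⁻ (step c e p) (inj₂ c∈) with ∈ᶜ-reindex⁻ p c∈
  ... | c' , c'∈ , eq = c' , inj₂ c'∈ , eq

  IsSimple-reindex : ∀ {a z} (p : Walk F a z) → IsSimple p → IsSimple (reindex p)
  IsSimple-reindex []           _          = tt
  IsSimple-reindex (step c e p) (a∉p , sp) = a∉p ∘ ∈ᵥ-reindex⁻ p , IsSimple-reindex p sp

  IsRainbow-reindex : Injective _≡_ _≡_ h → ∀ {a z} (p : Walk F a z) → IsRainbow p → IsRainbow (reindex p)
  IsRainbow-reindex h-inj []           _          = tt
  IsRainbow-reindex h-inj (step c e p) (c∉p , rp) = hc∉ , IsRainbow-reindex h-inj p rp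
    where
    hc∉ : ¬ (h c ∈ᶜ reindex p)
    hc∉ hc∈ with ∈ᶜ-reindex⁻ p hc∈
    ... | c' , c'∈ , eq with h-inj eq
    ... | refl = c∉p c'∈

module _ {A : Set} {N K : ℕ} {F : Fin N → EdgeSet A} (h : Fin K → Fin N) (h-inj : Injective _≡_ _≡_ h)
         (same-edges : ∀ c c' {u v} → Adj (F c) u v → Adj (F c') u v) where

  recolour : ∀ {a z} (p : Walk F a z) k → k + length p ≤ K → Walk F a z
  recolour []           k _     = []
  recolour (step c e p) k k+l≤K =
    step (h (fromℕ< (ℕₚ.<-≤-trans (ℕₚ.m<m+n k (s≤s z≤n)) k+l≤K))) (same-edges _ _ e)
         (recolour p (suc k) (subst (_≤ K) (ℕₚ.+-suc k (length p)) k+l≤K))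

  length-recolour : ∀ {a z} (p : Walk F a z) k le → length (recolour p k le) ≡ length p
  length-recolour []           k le = refl
  length-recolour (step c e p) k le = cong suc (length-recolour p _ _)

  ∈ᵥ-recolour⁻ : ∀ {a z x} (p : Walk F a z) k le → x ∈ᵥ recolour p k le → x ∈ᵥ p
  ∈ᵥ-recolour⁻ []           k le x∈        = x∈
  ∈ᵥ-recolour⁻ (step c e p) k le (inj₁ x≡) = inj₁ x≡
  ∈ᵥ-recolour⁻ (step c e p) k le (inj₂ x∈) = inj₂ (∈ᵥ-recolour⁻ p _ _ x∈)

  IsSimple-recolour : ∀ {a z} (p : Walk F a z) k le → IsSimple p → IsSimple (recolour p k le)
  IsSimple-recolour []           k le _          = tt
  IsSimple-recolour (step c e p) k le (a∉p , sp) = a∉p ∘ ∈ᵥ-recolour⁻ p _ _ , IsSimple-recolour p _ _ sp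

  ∈ᶜ-recolour⁻ : ∀ {a z c} (p : Walk F a z) k le → c ∈ᶜ recolour p k le → ∃[ j ] (k ≤ toℕ j × h j ≡ c)
  ∈ᶜ-recolour⁻ (step c e p) k le (inj₁ refl) = _ , ℕₚ.≤-reflexive (sym (Finₚ.toℕ-fromℕ< _)) , refl
  ∈ᶜ-recolour⁻ (step c e p) k le (inj₂ c∈) with ∈ᶜ-recolour⁻ p _ _ c∈
  ... | j , k<j , eq = j , ℕₚ.<⇒≤ k<j , eq

  IsRainbow-recolour : ∀ {a z} (p : Walk F a z) k le → IsRainbow (recolour p k le)
  IsRainbow-recolour []           k le = tt
  IsRainbow-recolour (step c e p) k le = hk∉ , IsRainbow-recolour p _ _
    where
    hk∉ : ¬ (_ ∈ᶜ recolour p _ _)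
    hk∉ hk∈ with ∈ᶜ-recolour⁻ p _ _ hk∈
    ... | j , k<j , eq = ℕₚ.<-irrefl refl (subst (k <_) (Finₚ.toℕ-fromℕ< _) (subst (λ t → k < toℕ t) (h-inj eq) k<j))

record ColouredCycle {A : Set} {N : ℕ} (F : Fin N → EdgeSet A) (M : ℕ) : Set where
  field
    vertex     : Fin (suc M) → A
    colour     : Fin (suc M) → Fin N
    vertex-inj : Injective _≡_ _≡_ vertex
    edge       : ∀ i → Adj (F (colour i)) (vertex i) (vertex (csuc i))

module _ {A : Set} {N : ℕ} {F : Fin N → EdgeSet A} where

  rotate : ∀ {M} → ColouredCycle F M → ℕ → ColouredCycle F M
  rotate D r = record
    { vertex     = vertex ∘ csuc^ r
    ; colour     = colour ∘ csuc^ r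
    ; vertex-inj = csuc^-injective r ∘ vertex-inj
    ; edge       = λ i → subst (Adj (F (colour (csuc^ r i))) (vertex (csuc^ r i)) ∘ vertex)
                               (sym (csuc^-csuc r i)) (edge (csuc^ r i))
    }
    where open ColouredCycle D

  cycle-edges-distinct : ∀ {M} (w : Fin (suc M) → A) → Injective _≡_ _≡_ w → 2 ≤ M → ∀ {i i'} →
                         SameEdge (w i) (w (csuc i)) (w i') (w (csuc i')) → i ≡ i'
  cycle-edges-distinct w w-inj _  (inj₁ (w≡ , _))          = w-inj w≡
  cycle-edges-distinct w w-inj 2≤M {i} {i'} (inj₂ (w≡ , w≡')) =
    ⊥-elim (csuc²≢id 2≤M i' (trans (cong csuc (sym (w-inj w≡))) (w-inj w≡')))

  ColouredCycle⇒RainbowOddCycle : ∀ {G : EdgeSet A} {M} (D : ColouredCycle F M) →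
    Injective _≡_ _≡_ (ColouredCycle.colour D) → 2 ≤ M → Odd (suc M) →
    (∀ i j → ColouredCycle.vertex D i ≢ ColouredCycle.vertex D j →
             Adj G (ColouredCycle.vertex D i) (ColouredCycle.vertex D j)) →
    RainbowOddCycleIn G F
  ColouredCycle⇒RainbowOddCycle {G} {M} D colour-inj 2≤M odd in-G =
    C , suc M , (s≤s 2≤M , vertex , vertex-inj , λ u v → mk⇔ toCycEdge fromCycEdge) ,
    odd , C⊆G , rainbow
    where
    open ColouredCycle D
    C : EdgeSet A
    C = CycEdge vertex
    toCycEdge : ∀ {u v} → Adj C u v → CycEdge vertex u v
    toCycEdge (_ , inj₁ e)       = e
    toCycEdge (_ , inj₂ (i , s)) = i , SameEdge-flipʳ s
    vertex≢next : ∀ i → vertex i ≢ vertex (csuc i)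
    vertex≢next i eq = csuc≢id (ℕₚ.≤-trans (s≤s z≤n) 2≤M) i (sym (vertex-inj eq))
    fromCycEdge : ∀ {u v} → CycEdge vertex u v → Adj C u v
    fromCycEdge (i , inj₁ (refl , refl)) = vertex≢next i , inj₁ (i , inj₁ (refl , refl))
    fromCycEdge (i , inj₂ (refl , refl)) = vertex≢next i ∘ sym , inj₁ (i , inj₂ (refl , refl))
    C⊆G : C ⊆E G
    C⊆G u v uv with toCycEdge uv
    ... | i , inj₁ (refl , refl) = in-G i (csuc i) (proj₁ uv)
    ... | i , inj₂ (refl , refl) = in-G (csuc i) i (proj₁ uv)
    position : ∀ {u v} → Adj C u v → Fin (suc M)
    position = proj₁ ∘ toCycEdge
    rainbow : Rainbow F C
    rainbow = record
      { σ     = colour ∘ position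
      ; σ-wd  = λ uv u'v' s → cong colour (cycle-edges-distinct vertex vertex-inj 2≤M
                  (SameEdge-trans (proj₂ (toCycEdge uv)) (SameEdge-trans s (SameEdge-sym (proj₂ (toCycEdge u'v'))))))
      ; σ-inj = σ-inj
      ; σ-mem = λ uv → Adj-resp-SameEdge {E = F (colour (position uv))} (proj₂ (toCycEdge uv)) (edge (position uv))
      }
      where
      σ-inj : ∀ {u v u' v'} (uv : Adj C u v) (u'v' : Adj C u' v') →
              colour (position uv) ≡ colour (position u'v') → SameEdge u v u' v'
      σ-inj uv u'v' eq with toCycEdge uv | toCycEdge u'v' | colour-inj eq
      ... | i , s | .i , s' | refl = SameEdge-trans (SameEdge-sym s) s'

  IsCycle⇒ColouredCycle : ∀ {C : EdgeSet A} {M} → IsCycle C (suc M) → Rainbow F C →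
    Σ (ColouredCycle F M) λ D → Injective _≡_ _≡_ (ColouredCycle.colour D) ×
      (∀ i → Adj C (ColouredCycle.vertex D i) (ColouredCycle.vertex D (csuc i)))
  IsCycle⇒ColouredCycle {C} (3≤L , w , w-inj , C⇔) rainbow =
    record { vertex = w ; colour = σ ∘ onC ; vertex-inj = w-inj ; edge = σ-mem ∘ onC } ,
    (λ {i} {i'} eq → cycle-edges-distinct w w-inj (ℕₚ.≤-pred 3≤L) (σ-inj (onC i) (onC i') eq)) ,
    onC
    where
    open Rainbow rainbow
    onC : ∀ i → Adj C (w i) (w (csuc i))
    onC i = Equivalence.from (C⇔ _ _) (i , inj₁ (refl , refl))

  vertexAt : ∀ {a z} (p : Walk F a z) → Fin (suc (length p)) → A
  vertexAt ([] {a})         _       = a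
  vertexAt (step {a} _ _ _) zero    = a
  vertexAt (step _ _ p)     (suc i) = vertexAt p i

  -- the colour of the i-th edge of p, and c for the edge closing p into a cycle
  colourAt : ∀ {a z} (p : Walk F a z) → Fin N → Fin (suc (length p)) → Fin N
  colourAt []            c _       = c
  colourAt (step c' _ _) c zero    = c'
  colourAt (step _ _ p)  c (suc i) = colourAt p c i

  vertexAt-∈ᵥ : ∀ {a z} (p : Walk F a z) i → vertexAt p i ∈ᵥ p
  vertexAt-∈ᵥ []           zero    = refl
  vertexAt-∈ᵥ (step c e p) zero    = inj₁ refl
  vertexAt-∈ᵥ (step c e p) (suc i) = inj₂ (vertexAt-∈ᵥ p i)

  vertexAt-zero : ∀ {a z} (p : Walk F a z) → vertexAt p zero ≡ a
  vertexAt-zero []           = refl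
  vertexAt-zero (step c e p) = refl

  vertexAt-last : ∀ {a z} (p : Walk F a z) → vertexAt p (fromℕ (length p)) ≡ z
  vertexAt-last []           = refl
  vertexAt-last (step c e p) = vertexAt-last p

  colourAt-last : ∀ {a z} (p : Walk F a z) c → colourAt p c (fromℕ (length p)) ≡ c
  colourAt-last []            c = refl
  colourAt-last (step c' e p) c = colourAt-last p c

  edgeAt : ∀ {a z} (p : Walk F a z) c (i : Fin (length p)) →
           Adj (F (colourAt p c (inject₁ i))) (vertexAt p (inject₁ i)) (vertexAt p (suc i))
  edgeAt (step c' e p) c zero    rewrite vertexAt-zero p = e
  edgeAt (step c' e p) c (suc i) = edgeAt p c i

  vertexAt-injective : ∀ {a z} (p : Walk F a z) → IsSimple p → Injective _≡_ _≡_ (vertexAt p)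
  vertexAt-injective []           _          {zero}  {zero}  _  = refl
  vertexAt-injective (step c e p) _          {zero}  {zero}  _  = refl
  vertexAt-injective (step c e p) (a∉p , _)  {zero}  {suc j} eq = ⊥-elim (a∉p (subst (_∈ᵥ p) (sym eq) (vertexAt-∈ᵥ p j)))
  vertexAt-injective (step c e p) (a∉p , _)  {suc i} {zero}  eq = ⊥-elim (a∉p (subst (_∈ᵥ p) eq (vertexAt-∈ᵥ p i)))
  vertexAt-injective (step c e p) (_ , sp)   {suc i} {suc j} eq = cong suc (vertexAt-injective p sp eq)

  colourAt-∈ᶜ : ∀ {a z} (p : Walk F a z) c i → colourAt p c i ≡ c ⊎ colourAt p c i ∈ᶜ p
  colourAt-∈ᶜ []            c i       = inj₁ refl
  colourAt-∈ᶜ (step c' e p) c zero    = inj₂ (inj₁ refl)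
  colourAt-∈ᶜ (step c' e p) c (suc i) with colourAt-∈ᶜ p c i
  ... | inj₁ eq = inj₁ eq
  ... | inj₂ c∈ = inj₂ (inj₂ c∈)

  colourAt-injective : ∀ {a z} (p : Walk F a z) c → IsRainbow p → ¬ (c ∈ᶜ p) → Injective _≡_ _≡_ (colourAt p c)
  colourAt-injective []            c _          _   {zero}  {zero}  _  = refl
  colourAt-injective (step c' e p) c _          _   {zero}  {zero}  _  = refl
  colourAt-injective (step c' e p) c (c'∉p , _) c∉  {zero}  {suc j} eq with colourAt-∈ᶜ p c j
  ... | inj₁ eq' = ⊥-elim (c∉ (inj₁ (sym (trans eq eq'))))
  ... | inj₂ c∈  = ⊥-elim (c'∉p (subst (_∈ᶜ p) (sym eq) c∈))
  colourAt-injective (step c' e p) c (c'∉p , _) c∉  {suc i} {zero}  eq with colourAt-∈ᶜ p c i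
  ... | inj₁ eq' = ⊥-elim (c∉ (inj₁ (trans (sym eq') eq)))
  ... | inj₂ c∈  = ⊥-elim (c'∉p (subst (_∈ᶜ p) eq c∈))
  colourAt-injective (step c' e p) c (_ , rp)   c∉  {suc i} {suc j} eq =
    cong suc (colourAt-injective p c rp (c∉ ∘ inj₂) eq)

  closeWalk : ∀ {a z} (p : Walk F a z) → IsSimple p → ∀ c → Adj (F c) z a → ColouredCycle F (length p)
  closeWalk {a} {z} p simple c closing = record
    { vertex = vertexAt p ; colour = colourAt p c ; vertex-inj = vertexAt-injective p simple ; edge = edge }
    where
    edge : ∀ i → Adj (F (colourAt p c i)) (vertexAt p i) (vertexAt p (csuc i))
    edge i with inject₁OrLast i
    ... | inject j rewrite csuc-inject₁ j = edgeAt p c j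
    ... | last rewrite csuc-fromℕ (length p) | vertexAt-last p | colourAt-last p c | vertexAt-zero p = closing

  closeToRainbowOddCycle : ∀ {G : EdgeSet A} {a z} (p : Walk F a z) → IsSimple p → IsRainbow p →
    ∀ c → ¬ (c ∈ᶜ p) → Adj (F c) z a → 2 ≤ length p → Odd (suc (length p)) →
    (∀ x y → x ∈ᵥ p → y ∈ᵥ p → x ≢ y → Adj G x y) → RainbowOddCycleIn G F
  closeToRainbowOddCycle p simple rainbow c c∉ closing 2≤len odd in-G =
    ColouredCycle⇒RainbowOddCycle (closeWalk p simple c closing)
      (colourAt-injective p c rainbow c∉) 2≤len odd
      (λ i j → in-G _ _ (vertexAt-∈ᵥ p i) (vertexAt-∈ᵥ p j))

shift : ∀ {M} o a → o + a ≤ M → Fin (suc a) → Fin (suc M)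
shift o a o+a≤M j = fromℕ< {o + toℕ j} (s≤s (ℕₚ.≤-trans (ℕₚ.+-monoʳ-≤ o (ℕₚ.≤-pred (Finₚ.toℕ<n j))) o+a≤M))

toℕ-shift : ∀ {M} o a le (j : Fin (suc a)) → toℕ (shift {M} o a le j) ≡ o + toℕ j
toℕ-shift o a le j = Finₚ.toℕ-fromℕ< _

shift-injective : ∀ {M} o a le → Injective _≡_ _≡_ (shift {M} o a le)
shift-injective o a le {i} {j} eq = Finₚ.toℕ-injective (ℕₚ.+-cancelˡ-≡ o _ _
  (trans (sym (toℕ-shift o a le i)) (trans (cong toℕ eq) (toℕ-shift o a le j))))

csuc-shift : ∀ {M} o a le (j : Fin a) → csuc (shift {M} o a le (inject₁ j)) ≡ shift o a le (suc j)
csuc-shift {M} o a le j with toℕ-csuc (shift {M} o a le (inject₁ j))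
... | inj₁ (_ , eq) = Finₚ.toℕ-injective (begin
  toℕ (csuc (shift o a le (inject₁ j))) ≡⟨ eq ⟩
  suc (toℕ (shift o a le (inject₁ j)))  ≡⟨ cong suc (toℕ-shift o a le (inject₁ j)) ⟩
  suc (o + toℕ (inject₁ j))             ≡⟨ cong (λ t → suc (o + t)) (Finₚ.toℕ-inject₁ j) ⟩
  suc (o + toℕ j)                       ≡⟨ sym (ℕₚ.+-suc o (toℕ j)) ⟩
  o + toℕ (suc j)                       ≡⟨ sym (toℕ-shift o a le (suc j)) ⟩
  toℕ (shift o a le (suc j))            ∎)
  where open ≡-Reasoning
... | inj₂ (eq , _) = ⊥-elim (ℕₚ.<-irrefl refl (ℕₚ.<-≤-trans M<o+a le))
  where
  M<o+a : M < o + a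
  M<o+a = subst (_< o + a) (trans (sym (toℕ-shift o a le (inject₁ j))) eq)
            (subst (λ t → o + t < o + a) (sym (Finₚ.toℕ-inject₁ j)) (ℕₚ.+-monoʳ-< o (Finₚ.toℕ<n j)))

module _ {A : Set} {N : ℕ} {F : Fin N → EdgeSet A} {M : ℕ} (D : ColouredCycle F M) where
  open ColouredCycle D

  segment : ∀ o a (le : o + a ≤ M) {x y} → vertex (shift o a le zero) ≡ x →
            vertex (shift o a le (fromℕ a)) ≡ y → Walk F x y
  segment o a le = walkAlong (vertex ∘ shift o a le) (colour ∘ shift o a le ∘ inject₁)
    (λ j → subst (Adj (F (colour (shift o a le (inject₁ j)))) (vertex (shift o a le (inject₁ j))) ∘ vertex)
                 (csuc-shift o a le j) (edge (shift o a le (inject₁ j))))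

  module _ o a (le : o + a ≤ M) {x y} (x≡ : vertex (shift o a le zero) ≡ x)
           (y≡ : vertex (shift o a le (fromℕ a)) ≡ y) where

    length-segment : length (segment o a le x≡ y≡) ≡ a
    length-segment = length-walkAlong _ _ _ x≡ y≡

    ∈ᵥ-segment⁻ : ∀ {v} → v ∈ᵥ segment o a le x≡ y≡ → ∃[ j ] vertex (shift o a le j) ≡ v
    ∈ᵥ-segment⁻ = ∈ᵥ-walkAlong⁻ _ _ _ x≡ y≡

    IsSimple-segment : IsSimple (segment o a le x≡ y≡)
    IsSimple-segment = IsSimple-walkAlong _ _ _ x≡ y≡ (shift-injective o a le ∘ vertex-inj)

record Arcs {A : Set} {N : ℕ} (F : Fin N → EdgeSet A) (M : ℕ) (x y : A) : Set where
  field
    arc₁ arc₂   : Walk F x y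
    simple₁     : IsSimple arc₁
    simple₂     : IsSimple arc₂
    length-sum  : length arc₁ + length arc₂ ≡ suc M
    nonempty₁   : 1 ≤ length arc₁
    nonempty₂   : 1 ≤ length arc₂

module _ {A : Set} {N : ℕ} {F : Fin N → EdgeSet A} {M : ℕ} where

  arcsFromZero : (D : ColouredCycle F M) (t : Fin (suc M)) → t ≢ zero →
                 Arcs F M (ColouredCycle.vertex D zero) (ColouredCycle.vertex D t)
  arcsFromZero D t t≢0 = record
    { arc₁ = arc₁ ; arc₂ = arc₂
    ; simple₁ = IsSimple-segment D 0 a a≤M refl arc₁-end
    ; simple₂ = IsSimple-reverse (around ++ʷ closing) (IsSimple-++ around closing
                  (IsSimple-segment D a b a+b≤M around-start around-end) (last≢zero , tt) meet)
    ; length-sum = trans (cong₂ _+_ (length-segment D 0 a a≤M refl arc₁-end) length₂)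
                         (trans (ℕₚ.+-suc a b) (cong suc (ℕₚ.m+[n∸m]≡n a≤M)))
    ; nonempty₁ = subst (1 ≤_) (sym (length-segment D 0 a a≤M refl arc₁-end)) 1≤a
    ; nonempty₂ = subst (1 ≤_) (sym length₂) (s≤s z≤n) }
    where
    open ColouredCycle D
    a = toℕ t
    a≤M : a ≤ M
    a≤M = ℕₚ.≤-pred (Finₚ.toℕ<n t)
    1≤a : 1 ≤ a
    1≤a = ℕₚ.n≢0⇒n>0 (t≢0 ∘ Finₚ.toℕ-injective)
    arc₁-end : vertex (shift 0 a a≤M (fromℕ a)) ≡ vertex t
    arc₁-end = cong vertex (Finₚ.toℕ-injective (trans (toℕ-shift 0 a a≤M (fromℕ a)) (Finₚ.toℕ-fromℕ a)))
    arc₁ = segment D 0 a a≤M refl arc₁-end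
    b = M ℕ.∸ a
    a+b≤M : a + b ≤ M
    a+b≤M = ℕₚ.≤-reflexive (ℕₚ.m+[n∸m]≡n a≤M)
    around-start : vertex (shift a b a+b≤M zero) ≡ vertex t
    around-start = cong vertex (Finₚ.toℕ-injective (trans (toℕ-shift a b a+b≤M zero) (ℕₚ.+-identityʳ a)))
    around-end : vertex (shift a b a+b≤M (fromℕ b)) ≡ vertex (fromℕ M)
    around-end = cong vertex (Finₚ.toℕ-injective (begin
      toℕ (shift a b a+b≤M (fromℕ b)) ≡⟨ toℕ-shift a b a+b≤M (fromℕ b) ⟩
      a + toℕ (fromℕ b)               ≡⟨ cong (a +_) (Finₚ.toℕ-fromℕ b) ⟩
      a + b                           ≡⟨ ℕₚ.m+[n∸m]≡n a≤M ⟩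
      M                               ≡⟨ sym (Finₚ.toℕ-fromℕ M) ⟩
      toℕ (fromℕ M)                   ∎))
      where open ≡-Reasoning
    around : Walk F (vertex t) (vertex (fromℕ M))
    around = segment D a b a+b≤M around-start around-end
    closing : Walk F (vertex (fromℕ M)) (vertex zero)
    closing = step (colour (fromℕ M))
      (subst (Adj (F (colour (fromℕ M))) (vertex (fromℕ M)) ∘ vertex) (csuc-fromℕ M) (edge (fromℕ M))) []
    arc₂ = reverse (around ++ʷ closing)
    last≢zero : vertex (fromℕ M) ≢ vertex zero
    last≢zero eq = ℕₚ.<⇒≢ (ℕₚ.≤-trans 1≤a a≤M) (sym (trans (sym (Finₚ.toℕ-fromℕ M)) (cong toℕ (vertex-inj eq))))
    meet : ∀ v → v ∈ᵥ around → v ∈ᵥ closing → v ≡ vertex (fromℕ M)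
    meet v v∈ (inj₁ eq)   = eq
    meet v v∈ (inj₂ refl) with ∈ᵥ-segment⁻ D a b a+b≤M around-start around-end v∈
    ... | j , eq = ⊥-elim (ℕₚ.<-irrefl (sym position≡0)
      (ℕₚ.<-≤-trans 1≤a (ℕₚ.≤-trans (ℕₚ.m≤m+n a (toℕ j)) (ℕₚ.≤-reflexive (sym (toℕ-shift a b a+b≤M j))))))
      where
      position≡0 : toℕ (shift a b a+b≤M j) ≡ 0
      position≡0 = cong toℕ (vertex-inj eq)
    length₂ : length arc₂ ≡ suc b
    length₂ = begin
      length arc₂                             ≡⟨ length-reverse (around ++ʷ closing) ⟩
      length (around ++ʷ closing)             ≡⟨ length-++ around closing ⟩
      length around + 1                       ≡⟨ cong (_+ 1) (length-segment D a b a+b≤M around-start around-end) ⟩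
      b + 1                                   ≡⟨ ℕₚ.+-comm b 1 ⟩
      suc b                                   ∎
      where open ≡-Reasoning

  arcs : (D : ColouredCycle F M) (s t : Fin (suc M)) → s ≢ t →
         Arcs F M (ColouredCycle.vertex D s) (ColouredCycle.vertex D t)
  arcs D s t s≢t = subst₂ (Arcs F M) (cong vertex (csuc^-toℕ-zero s)) (cong vertex t'↦t)
    (arcsFromZero D' t' (λ t'≡0 → s≢t (trans (sym (csuc^-toℕ-zero s)) (trans (cong (csuc^ r) (sym t'≡0)) t'↦t))))
    where
    open ColouredCycle D
    r = toℕ s
    D' = rotate D r
    t' = proj₁ (csuc^-surjective r t)
    t'↦t : csuc^ r t' ≡ t
    t'↦t = proj₂ (csuc^-surjective r t)

record RainbowPath {A : Set} {N : ℕ} (F : Fin N → EdgeSet A) (x y : A) : Set where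
  field
    walk    : Walk F x y
    simple  : IsSimple walk
    rainbow : IsRainbow walk

open RainbowPath

record Subfamily {A : Set} {N : ℕ} (F : Fin N → EdgeSet A) : Set where
  field
    size      : ℕ
    index     : Fin size → Fin N
    index-inj : Injective _≡_ _≡_ index

  members : Fin size → EdgeSet A
  members = F ∘ index

open Subfamily

module _ {A : Set} {N : ℕ} {F : Fin N → EdgeSet A} where

  VS-⋃-members⇒VS-⋃ : (P : Subfamily F) → ∀ {v} → VS (⋃ (members P)) v → VS (⋃ F) v
  VS-⋃-members⇒VS-⋃ P (u , vu) with Adj-⋃⇒Adj {F = members P} vu
  ... | c , vu' = u , Adj⇒Adj-⋃ {F = F} (index P c) vu'

  liftPath : (P : Subfamily F) → ∀ {x y} → RainbowPath (members P) x y → RainbowPath F x y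
  liftPath P p = record
    { walk    = reindex (index P) (λ _ e → e) (walk p)
    ; simple  = IsSimple-reindex _ _ (walk p) (simple p)
    ; rainbow = IsRainbow-reindex _ _ (index-inj P) (walk p) (rainbow p) }

  length-liftPath : (P : Subfamily F) → ∀ {x y} (p : RainbowPath (members P) x y) →
                    length (walk (liftPath P p)) ≡ length (walk p)
  length-liftPath P p = length-reindex _ _ (walk p)

  ∈ᶜ-liftPath⁻ : (P : Subfamily F) → ∀ {x y c} (p : RainbowPath (members P) x y) →
                 c ∈ᶜ walk (liftPath P p) → ∃[ c' ] (c' ∈ᶜ walk p × index P c' ≡ c)
  ∈ᶜ-liftPath⁻ P p = ∈ᶜ-reindex⁻ _ _ (walk p)

  liftPath-avoids : (P : Subfamily F) → ∀ {x y c} (p : RainbowPath (members P) x y) →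
                    ¬ (c ∈ᶜ walk p) → ¬ (index P c ∈ᶜ walk (liftPath P p))
  liftPath-avoids P p c∉ c∈ with ∈ᶜ-liftPath⁻ P p c∈
  ... | c' , c'∈ , eq with index-inj P eq
  ... | refl = c∉ c'∈

  liftPath-avoids-outside : (P : Subfamily F) → ∀ {x y d} (p : RainbowPath (members P) x y) →
                            (∀ c → index P c ≢ d) → ¬ (d ∈ᶜ walk (liftPath P p))
  liftPath-avoids-outside P p outside d∈ with ∈ᶜ-liftPath⁻ P p d∈
  ... | c , _ , eq = outside c eq

  record Touching (P Q : Subfamily F) (z : A) : Set where
    field
      disjoint : ∀ c c' → index P c ≢ index Q c'
      meet     : ∀ v → VS (⋃ (members P)) v → VS (⋃ (members Q)) v → v ≡ z

  module _ {P Q : Subfamily F} {z : A} (PQ : Touching P Q z) where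
    open Touching PQ

    joinPaths : ∀ {x y} (p : RainbowPath (members P) x z) (q : RainbowPath (members Q) z y) →
                x ≢ z → z ≢ y → RainbowPath F x y
    joinPaths p q x≢z z≢y = record
      { walk    = walk p' ++ʷ walk q'
      ; simple  = IsSimple-++ (walk p') (walk q') (simple p') (simple q') meet'
      ; rainbow = IsRainbow-++ (walk p') (walk q') (rainbow p') (rainbow q') disjoint' }
      where
      p' = liftPath P p
      q' = liftPath Q q
      meet' : ∀ v → v ∈ᵥ walk p' → v ∈ᵥ walk q' → v ≡ z
      meet' v v∈p v∈q = meet v (∈ᵥ-nonempty⇒VS-⋃ (walk p) x≢z (∈ᵥ-reindex⁻ _ _ (walk p) v∈p))
                               (∈ᵥ-nonempty⇒VS-⋃ (walk q) z≢y (∈ᵥ-reindex⁻ _ _ (walk q) v∈q))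
      disjoint' : ∀ c → c ∈ᶜ walk p' → c ∈ᶜ walk q' → ⊥
      disjoint' c c∈p c∈q with ∈ᶜ-liftPath⁻ P p c∈p | ∈ᶜ-liftPath⁻ Q q c∈q
      ... | c₁ , _ , eq₁ | c₂ , _ , eq₂ = disjoint c₁ c₂ (trans eq₁ (sym eq₂))

    module _ {x y} (p : RainbowPath (members P) x z) (q : RainbowPath (members Q) z y)
             (x≢z : x ≢ z) (z≢y : z ≢ y) where

      isEven-joinPaths : isEven (length (walk (joinPaths p q x≢z z≢y))) ≡
                         xnor (isEven (length (walk p))) (isEven (length (walk q)))
      isEven-joinPaths = begin
        isEven (length (walk (liftPath P p) ++ʷ walk (liftPath Q q)))
          ≡⟨ cong isEven (length-++ (walk (liftPath P p)) _) ⟩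
        isEven (length (walk (liftPath P p)) + length (walk (liftPath Q q)))
          ≡⟨ cong isEven (cong₂ _+_ (length-liftPath P p) (length-liftPath Q q)) ⟩
        isEven (length (walk p) + length (walk q))
          ≡⟨ isEven-+ (length (walk p)) (length (walk q)) ⟩
        xnor (isEven (length (walk p))) (isEven (length (walk q))) ∎
        where open ≡-Reasoning

      ∈ᶜ-joinPaths⁻ : ∀ {c} → c ∈ᶜ walk (joinPaths p q x≢z z≢y) →
                      c ∈ᶜ walk (liftPath P p) ⊎ c ∈ᶜ walk (liftPath Q q)
      ∈ᶜ-joinPaths⁻ = ∈ᶜ-++⁻ (walk (liftPath P p)) _

  Touching-sym : ∀ {P Q z} → Touching P Q z → Touching Q P z
  Touching-sym PQ = record { disjoint = λ c c' eq → disjoint c' c (sym eq) ; meet = λ v vQ vP → meet v vP vQ }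
    where open Touching PQ

  module Split {N₁ N₂} (σ : Fin (N₁ + N₂) ↔ Fin N) where
    open Inverse σ

    to-inj : Injective _≡_ _≡_ to
    to-inj {a} {b} eq = trans (sym (strictlyInverseʳ a)) (trans (cong from eq) (strictlyInverseʳ b))

    left : Subfamily F
    left = record { size = N₁ ; index = to ∘ (_↑ˡ N₂) ; index-inj = Finₚ.↑ˡ-injective N₂ _ _ ∘ to-inj }

    right : Subfamily F
    right = record { size = N₂ ; index = to ∘ (N₁ ↑ʳ_) ; index-inj = Finₚ.↑ʳ-injective N₁ _ _ ∘ to-inj }

    left≢right : ∀ c c' → index left c ≢ index right c'
    left≢right c c' = ↑ˡ≢↑ʳ c c' ∘ to-inj

    touching : ∀ {z} → (∀ v → VS (⋃ (members left)) v → VS (⋃ (members right)) v → v ≡ z) →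
               Touching left right z
    touching meet = record { disjoint = left≢right ; meet = meet }

    classify : ∀ i → (∃[ c ] index left c ≡ i) ⊎ (∃[ c ] index right c ≡ i)
    classify i with Fin.splitAt N₁ (from i) in eq
    ... | inj₁ c = inj₁ (c , trans (cong to (trans (cong (Fin.join N₁ N₂) (sym eq)) (Finₚ.join-splitAt N₁ N₂ (from i)))) (strictlyInverseˡ i))
    ... | inj₂ c = inj₂ (c , trans (cong to (trans (cong (Fin.join N₁ N₂) (sym eq)) (Finₚ.join-splitAt N₁ N₂ (from i)))) (strictlyInverseˡ i))

    VS-⋃-classify : ∀ {x} → VS (⋃ F) x → VS (⋃ (members left)) x ⊎ VS (⋃ (members right)) x
    VS-⋃-classify (u , xu) with Adj-⋃⇒Adj {F = F} xu
    ... | i , xu' with classify i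
    ... | inj₁ (c , refl) = inj₁ (u , Adj⇒Adj-⋃ {F = members left} c xu')
    ... | inj₂ (c , refl) = inj₂ (u , Adj⇒Adj-⋃ {F = members right} c xu')

m+n≡1+k⇒m≤k : ∀ {m n k} → m + n ≡ suc k → 1 ≤ n → m ≤ k
m+n≡1+k⇒m≤k {m} {n} {k} eq 1≤n = ℕₚ.≤-pred (begin
  suc m   ≡⟨ ℕₚ.+-comm 1 m ⟩
  m + 1   ≤⟨ ℕₚ.+-monoʳ-≤ m 1≤n ⟩
  m + n   ≡⟨ eq ⟩
  suc k   ∎)
  where open ℕₚ.≤-Reasoning

m+n≡3+k⇒m≤1+k⊎n≤1+k : ∀ m n k → m + n ≡ 3 + k → m ≤ suc k ⊎ n ≤ suc k
m+n≡3+k⇒m≤1+k⊎n≤1+k m n k eq with m ℕₚ.≤? suc k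
... | yes m≤ = inj₁ m≤
... | no  m≰ = inj₂ (ℕₚ.≤-trans (ℕₚ.+-cancelˡ-≤ (2 + k) n 1 (begin
  2 + k + n ≤⟨ ℕₚ.+-monoˡ-≤ n (ℕₚ.≰⇒> m≰) ⟩
  m + n     ≡⟨ eq ⟩
  3 + k     ≡⟨ ℕₚ.+-comm 1 (2 + k) ⟩
  2 + k + 1 ∎)) (s≤s z≤n))
  where open ℕₚ.≤-Reasoning

module SingleCycle {A : Set} {N' : ℕ} {F : Fin (suc (suc N')) → EdgeSet A} {C : EdgeSet A}
                   (C-cycle : IsCycle C (3 + N')) (F≐C : ∀ i → F i ≐ C) where
  N : ℕ
  N = 2 + N'

  w : Fin (suc N) → A
  w = proj₁ (proj₂ C-cycle)

  same-edges : ∀ c c' {u v} → Adj (F c) u v → Adj (F c') u v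
  same-edges c c' e = Equivalence.from (F≐C c' _ _) (Equivalence.to (F≐C c _ _) e)

  cycle-edge : ∀ i → Adj C (w i) (w (csuc i))
  cycle-edge i = Equivalence.from (proj₂ (proj₂ (proj₂ C-cycle)) _ _) (i , inj₁ (refl , refl))

  D : ColouredCycle F N
  D = record { vertex = w ; colour = λ _ → zero ; vertex-inj = proj₁ (proj₂ (proj₂ C-cycle))
             ; edge = λ i → Equivalence.from (F≐C zero _ _) (cycle-edge i) }

  VS-C⇒position : ∀ {x} → VS C x → ∃[ s ] w s ≡ x
  VS-C⇒position (y , xy) with Equivalence.to (proj₂ (proj₂ (proj₂ C-cycle)) _ _) xy
  ... | i , inj₁ (eq , _) = i , eq
  ... | i , inj₂ (_ , eq) = csuc i , eq

  VS-member⇒position : ∀ i {x} → VS (F i) x → ∃[ s ] w s ≡ x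
  VS-member⇒position i (y , xy) = VS-C⇒position (y , Equivalence.to (F≐C i _ _) xy)

  position⇒VS-member : ∀ i s → VS (F i) (w s)
  position⇒VS-member i s = _ , Equivalence.from (F≐C i _ _) (cycle-edge s)

  VS-⋃⇒position : ∀ {x} → VS (⋃ F) x → ∃[ s ] w s ≡ x
  VS-⋃⇒position (y , xy) with Adj-⋃⇒Adj {F = F} xy
  ... | i , xy' = VS-member⇒position i (y , xy')

  position⇒VS-⋃ : ∀ s → VS (⋃ F) (w s)
  position⇒VS-⋃ s = _ , Adj⇒Adj-⋃ {F = F} zero (proj₂ (position⇒VS-member zero s))

  recoloured : ∀ {K} (h : Fin K → Fin N) → Injective _≡_ _≡_ h → ∀ {x y} (q : Walk F x y) → IsSimple q →
               length q ≤ K → Σ (RainbowPath F x y) λ p →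
                 length (walk p) ≡ length q × (∀ c → c ∈ᶜ walk p → ∃[ j ] h j ≡ c)
  recoloured h h-inj q simple-q len≤K =
    record { walk = recolour h h-inj same-edges q 0 len≤K
           ; simple = IsSimple-recolour h h-inj same-edges q 0 len≤K simple-q
           ; rainbow = IsRainbow-recolour h h-inj same-edges q 0 len≤K } ,
    length-recolour h h-inj same-edges q 0 len≤K ,
    λ c c∈ → let (j , _ , eq) = ∈ᶜ-recolour⁻ h h-inj same-edges q 0 len≤K c∈ in j , eq

  -- the two arcs have odd total length N + 1, so one of them has parity b
  path-of-parity : Odd (suc N) → ∀ s t → s ≢ t → ∀ b →
                   Σ (RainbowPath F (w s) (w t)) λ p → isEven (length (walk p)) ≡ b
  path-of-parity odd s t s≢t b with isEven (length arc₁) Boolₚ.≟ b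
    where open Arcs (arcs D s t s≢t)
  ... | yes parity₁ = let (p , length-p , _) = recoloured (λ j → j) (λ eq → eq) arc₁ simple₁
                                                 (m+n≡1+k⇒m≤k length-sum nonempty₂)
                      in p , trans (cong isEven length-p) parity₁
    where open Arcs (arcs D s t s≢t)
  ... | no ¬parity₁ = let (p , length-p , _) = recoloured (λ j → j) (λ eq → eq) arc₂ simple₂
                                                 (m+n≡1+k⇒m≤k (trans (ℕₚ.+-comm (length arc₂) _) length-sum) nonempty₁)
                      in p , trans (cong isEven length-p) parity₂
    where
    open Arcs (arcs D s t s≢t)
    parity₂ : isEven (length arc₂) ≡ b
    parity₂ = xnor-false _ _ b (begin
      xnor (isEven (length arc₁)) (isEven (length arc₂)) ≡⟨ isEven-+ (length arc₁) (length arc₂) ⟨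
      isEven (length arc₁ + length arc₂)                 ≡⟨ cong isEven length-sum ⟩
      isEven (suc N)                                     ≡⟨ Odd⇒isEven _ odd ⟩
      false                                              ∎) ¬parity₁
      where open ≡-Reasoning

  -- the shorter arc has at most N - 1 edges, so it can be coloured avoiding any one member
  path-avoiding : ∀ i s t → s ≢ t → Σ (RainbowPath F (w s) (w t)) λ p → ¬ (i ∈ᶜ walk p)
  path-avoiding i s t s≢t = [ avoidingAlong arc₁ simple₁ , avoidingAlong arc₂ simple₂ ]′
    (m+n≡3+k⇒m≤1+k⊎n≤1+k (length arc₁) (length arc₂) N' length-sum)
    where
    open Arcs (arcs D s t s≢t)
    avoidingAlong : (q : Walk F (w s) (w t)) → IsSimple q → length q ≤ suc N' →
                    Σ (RainbowPath F (w s) (w t)) λ p → ¬ (i ∈ᶜ walk p)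
    avoidingAlong q simple-q short with recoloured (Fin.punchIn i) (Finₚ.punchIn-injective i _ _) q simple-q short
    ... | p , _ , colours = p , λ i∈ → let (j , eq) = colours i i∈ in Finₚ.punchInᵢ≢i i j eq

OddCycles : ∀ {A : Set} {N} → (Fin N → EdgeSet A) → Set
OddCycles {N = N} F = ∀ (i : Fin N) → ∃[ L ] (IsCycle (F i) L × Odd L)

module _ {A : Set} where

  IsCycle-length-≤ : ∀ {C C' : EdgeSet A} {L L'} → IsCycle C L → IsCycle C' L' → C ⊆E C' → L ≤ L'
  IsCycle-length-≤ {C} {C'} {L} {L'} (_ , w , w-inj , C⇔) (_ , w' , _ , C'⇔) C⊆C' =
    Finₚ.injective⇒≤ position-inj
    where
    position : Fin L → Fin L'
    position i with Equivalence.to (C'⇔ _ _) (C⊆C' _ _ (Equivalence.from (C⇔ _ _) (i , inj₁ (refl , refl))))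
    ... | j , inj₁ _ = j
    ... | j , inj₂ _ = csuc j
    position-correct : ∀ i → w' (position i) ≡ w i
    position-correct i with Equivalence.to (C'⇔ _ _) (C⊆C' _ _ (Equivalence.from (C⇔ _ _) (i , inj₁ (refl , refl))))
    ... | j , inj₁ (eq , _) = eq
    ... | j , inj₂ (_ , eq) = eq
    position-inj : Injective _≡_ _≡_ position
    position-inj {i} {j} eq = w-inj (trans (sym (position-correct i)) (trans (cong w' eq) (position-correct j)))

  IsCycle-length-unique : ∀ {C C' : EdgeSet A} {L L'} → IsCycle C L → IsCycle C' L' → C ≐ C' → L ≡ L'
  IsCycle-length-unique C-cycle C'-cycle C≐C' = ℕₚ.≤-antisym
    (IsCycle-length-≤ C-cycle C'-cycle (λ u v → Equivalence.to (C≐C' u v)))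
    (IsCycle-length-≤ C'-cycle C-cycle (λ u v → Equivalence.from (C≐C' u v)))

  VS-cycle? : ∀ {C : EdgeSet A} {L} → DecidableEquality A → IsCycle C L → (x : A) → Dec (VS C x)
  VS-cycle? _≟_ (_ , w , _ , C⇔) x with Finₚ.any? (λ j → w j ≟ x)
  ... | yes (j , refl) = yes (_ , Equivalence.from (C⇔ _ _) (j , inj₁ (refl , refl)))
  ... | no ¬∃j         = no λ { (y , xy) → ¬∃j (onCycle (Equivalence.to (C⇔ _ _) xy)) }
    where
    onCycle : ∀ {y} → CycEdge w x y → ∃[ j ] w j ≡ x
    onCycle (i , inj₁ (eq , _)) = i , eq
    onCycle (i , inj₂ (_ , eq)) = csuc i , eq

module CactusPaths {A : Set} (_≟_ : DecidableEquality A) where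

  PathOfParity : ∀ {N} → (Fin N → EdgeSet A) → A → A → Bool → Set
  PathOfParity F x y b = Σ (RainbowPath F x y) λ p → isEven (length (walk p)) ≡ b

  PathAvoiding : ∀ {N} → (Fin N → EdgeSet A) → Fin N → A → A → Set
  PathAvoiding F i x y = Σ (RainbowPath F x y) λ p → ¬ (i ∈ᶜ walk p)

  EvenPathAvoiding : ∀ {N} → (Fin N → EdgeSet A) → Fin N → A → A → Set
  EvenPathAvoiding F i x y = Σ (RainbowPath F x y) λ p → ¬ (i ∈ᶜ walk p) × isEven (length (walk p)) ≡ true

  module _ {N} {F : Fin N → EdgeSet A} where

    liftPathOfParity : (P : Subfamily F) → ∀ {x y b} → PathOfParity (members P) x y b → PathOfParity F x y b
    liftPathOfParity P (p , parity) = liftPath P p , trans (cong isEven (length-liftPath P p)) parity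

    liftPathAvoiding : (P : Subfamily F) → ∀ {c x y} → PathAvoiding (members P) c x y →
                       PathAvoiding F (index P c) x y
    liftPathAvoiding P (p , c∉) = liftPath P p , liftPath-avoids P p c∉

    liftEvenPathAvoiding : (P : Subfamily F) → ∀ {c x y} → EvenPathAvoiding (members P) c x y →
                           EvenPathAvoiding F (index P c) x y
    liftEvenPathAvoiding P (p , c∉ , even) =
      liftPath P p , liftPath-avoids P p c∉ , trans (cong isEven (length-liftPath P p)) even

    module _ {P Q : Subfamily F} {z} (PQ : Touching P Q z)
             (z∈P : VS (⋃ (members P)) z) (z∈Q : VS (⋃ (members Q)) z) where
      open Touching PQ

      path-of-parity-across :
        (∀ x y → VS (⋃ (members P)) x → VS (⋃ (members P)) y → x ≢ y → ∀ b → PathOfParity (members P) x y b) →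
        (∀ x y → VS (⋃ (members Q)) x → VS (⋃ (members Q)) y → x ≢ y → ∀ b → PathOfParity (members Q) x y b) →
        ∀ x y → VS (⋃ (members P)) x → VS (⋃ (members Q)) y → x ≢ y → ∀ b → PathOfParity F x y b
      path-of-parity-across pathsP pathsQ x y x∈P y∈Q x≢y b with x ≟ z | y ≟ z
      ... | yes refl | _        = liftPathOfParity Q (pathsQ x y z∈Q y∈Q x≢y b)
      ... | no _     | yes refl = liftPathOfParity P (pathsP x y x∈P z∈P x≢y b)
      ... | no x≢z   | no y≢z   with pathsP x z x∈P z∈P x≢z true | pathsQ z y z∈Q y∈Q (y≢z ∘ sym) b
      ... | p , even | q , parity =
        joinPaths PQ p q x≢z (y≢z ∘ sym) ,
        trans (isEven-joinPaths PQ p q x≢z (y≢z ∘ sym)) (cong₂ xnor even parity)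

      -- an even path through z: first across Q to z with the parity of the continuation in P
      even-path-avoiding-across : OddCycles (members P) →
        (∀ c x y → VS (members P c) y → ¬ VS (members P c) x → VS (⋃ (members P)) x →
                   EvenPathAvoiding (members P) c x y) →
        (∀ c x y → VS (members P c) x → VS (members P c) y → x ≢ y → PathAvoiding (members P) c x y) →
        (∀ x y → VS (⋃ (members Q)) x → VS (⋃ (members Q)) y → x ≢ y → ∀ b → PathOfParity (members Q) x y b) →
        ∀ c x y → VS (members P c) y → ¬ VS (members P c) x → VS (⋃ (members Q)) x →
        EvenPathAvoiding F (index P c) x y
      even-path-avoiding-across oddP evenPathsP avoidingP pathsQ c x y y∈c x∉c x∈Q with x ≟ z | z ≟ y
      ... | yes refl | _        = liftEvenPathAvoiding P (evenPathsP c x y y∈c x∉c z∈P)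
      ... | no x≢z   | yes refl with pathsQ x z x∈Q z∈Q x≢z true
      ... | p , even = liftPath Q p , liftPath-avoids-outside Q p (λ c' eq → disjoint c c' (sym eq)) ,
                       trans (cong isEven (length-liftPath Q p)) even
      even-path-avoiding-across oddP evenPathsP avoidingP pathsQ c x y y∈c x∉c x∈Q
        | no x≢z | no z≢y with continuation (VS-cycle? _≟_ (proj₁ (proj₂ (oddP c))) z)
        where
        continuation : Dec (VS (members P c) z) → PathAvoiding (members P) c z y
        continuation (yes z∈c) = avoidingP c z y z∈c y∈c z≢y
        continuation (no z∉c)  = let (q , c∉ , _) = evenPathsP c z y y∈c z∉c z∈P in q , c∉
      ... | q , c∉q with pathsQ x z x∈Q z∈Q x≢z (isEven (length (walk q)))
      ... | p , parity = joinPaths QP p q x≢z z≢y , c∉ , even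
        where
        QP = Touching-sym PQ
        c∉ : ¬ (index P c ∈ᶜ walk (joinPaths QP p q x≢z z≢y))
        c∉ c∈ with ∈ᶜ-joinPaths⁻ QP p q x≢z z≢y c∈
        ... | inj₁ c∈p = liftPath-avoids-outside Q p (λ c' eq → disjoint c c' (sym eq)) c∈p
        ... | inj₂ c∈q = liftPath-avoids P q c∉q c∈q
        even : isEven (length (walk (joinPaths QP p q x≢z z≢y))) ≡ true
        even = trans (isEven-joinPaths QP p q x≢z z≢y)
                     (trans (cong (λ b → xnor b _) parity) (xnor-diag (isEven (length (walk q)))))

    module _ {P Q : Subfamily F} {z} (PQ : Touching P Q z)
             (z∈P : VS (⋃ (members P)) z) (z∈Q : VS (⋃ (members Q)) z)
             (classify : ∀ i → (∃[ c ] index P c ≡ i) ⊎ (∃[ c ] index Q c ≡ i))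
             (VS-⋃-classify : ∀ {x} → VS (⋃ F) x → VS (⋃ (members P)) x ⊎ VS (⋃ (members Q)) x) where

      path-of-parity-⋃ :
        (∀ x y → VS (⋃ (members P)) x → VS (⋃ (members P)) y → x ≢ y → ∀ b → PathOfParity (members P) x y b) →
        (∀ x y → VS (⋃ (members Q)) x → VS (⋃ (members Q)) y → x ≢ y → ∀ b → PathOfParity (members Q) x y b) →
        ∀ x y → VS (⋃ F) x → VS (⋃ F) y → x ≢ y → ∀ b → PathOfParity F x y b
      path-of-parity-⋃ pathsP pathsQ x y x∈ y∈ x≢y b with VS-⋃-classify x∈ | VS-⋃-classify y∈
      ... | inj₁ x∈P | inj₁ y∈P = liftPathOfParity P (pathsP x y x∈P y∈P x≢y b)
      ... | inj₂ x∈Q | inj₂ y∈Q = liftPathOfParity Q (pathsQ x y x∈Q y∈Q x≢y b)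
      ... | inj₁ x∈P | inj₂ y∈Q = path-of-parity-across PQ z∈P z∈Q pathsP pathsQ x y x∈P y∈Q x≢y b
      ... | inj₂ x∈Q | inj₁ y∈P = path-of-parity-across (Touching-sym PQ) z∈Q z∈P pathsQ pathsP x y x∈Q y∈P x≢y b

      path-avoiding-⋃ :
        (∀ c x y → VS (members P c) x → VS (members P c) y → x ≢ y → PathAvoiding (members P) c x y) →
        (∀ c x y → VS (members Q c) x → VS (members Q c) y → x ≢ y → PathAvoiding (members Q) c x y) →
        ∀ i x y → VS (F i) x → VS (F i) y → x ≢ y → PathAvoiding F i x y
      path-avoiding-⋃ avoidingP avoidingQ i x y x∈ y∈ x≢y with classify i
      ... | inj₁ (c , refl) = liftPathAvoiding P (avoidingP c x y x∈ y∈ x≢y)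
      ... | inj₂ (c , refl) = liftPathAvoiding Q (avoidingQ c x y x∈ y∈ x≢y)

      even-path-avoiding-⋃ : OddCycles (members P) → OddCycles (members Q) →
        (∀ c x y → VS (members P c) y → ¬ VS (members P c) x → VS (⋃ (members P)) x →
                   EvenPathAvoiding (members P) c x y) →
        (∀ c x y → VS (members Q c) y → ¬ VS (members Q c) x → VS (⋃ (members Q)) x →
                   EvenPathAvoiding (members Q) c x y) →
        (∀ c x y → VS (members P c) x → VS (members P c) y → x ≢ y → PathAvoiding (members P) c x y) →
        (∀ c x y → VS (members Q c) x → VS (members Q c) y → x ≢ y → PathAvoiding (members Q) c x y) →
        (∀ x y → VS (⋃ (members P)) x → VS (⋃ (members P)) y → x ≢ y → ∀ b → PathOfParity (members P) x y b) →
        (∀ x y → VS (⋃ (members Q)) x → VS (⋃ (members Q)) y → x ≢ y → ∀ b → PathOfParity (members Q) x y b) →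
        ∀ i x y → VS (F i) y → ¬ VS (F i) x → VS (⋃ F) x → EvenPathAvoiding F i x y
      even-path-avoiding-⋃ oddP oddQ evenP evenQ avoidingP avoidingQ pathsP pathsQ i x y y∈ x∉ x∈
        with classify i | VS-⋃-classify x∈
      ... | inj₁ (c , refl) | inj₁ x∈P = liftEvenPathAvoiding P (evenP c x y y∈ x∉ x∈P)
      ... | inj₂ (c , refl) | inj₂ x∈Q = liftEvenPathAvoiding Q (evenQ c x y y∈ x∉ x∈Q)
      ... | inj₁ (c , refl) | inj₂ x∈Q =
        even-path-avoiding-across PQ z∈P z∈Q oddP evenP avoidingP pathsQ c x y y∈ x∉ x∈Q
      ... | inj₂ (c , refl) | inj₁ x∈P =
        even-path-avoiding-across (Touching-sym PQ) z∈Q z∈P oddQ evenQ avoidingQ pathsP c x y y∈ x∉ x∈P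

  cactus-path-of-parity : ∀ {N F} → PrunedCactus {A} N F → OddCycles F →
    ∀ x y → VS (⋃ F) x → VS (⋃ F) y → x ≢ y → ∀ b → PathOfParity F x y b
  cactus-path-of-parity (base C C-cycle@(s≤s (s≤s (s≤s z≤n)) , _) F≐C) odd x y x∈ y∈ x≢y b
    with SingleCycle.VS-⋃⇒position C-cycle F≐C x∈ | SingleCycle.VS-⋃⇒position C-cycle F≐C y∈
  ... | s , refl | t , refl = path-of-parity oddLength s t (x≢y ∘ cong w) b
    where
    open SingleCycle C-cycle F≐C
    oddLength : Odd (suc N)
    oddLength with odd zero
    ... | L , L-cycle , oddL = subst Odd (IsCycle-length-unique L-cycle C-cycle (F≐C zero)) oddL
  cactus-path-of-parity {F = F} (split {N₁ = N₁} {N₂ = N₂} σ c₁ c₂ (z , z₁ , z₂ , meet)) odd =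
    path-of-parity-⋃ (touching meet) z₁ z₂ classify VS-⋃-classify
      (cactus-path-of-parity c₁ (odd ∘ index left)) (cactus-path-of-parity c₂ (odd ∘ index right))
    where open Split {F = F} {N₁ = N₁} {N₂ = N₂} σ

  cactus-path-avoiding : ∀ {N F} → PrunedCactus {A} N F →
    ∀ i x y → VS (F i) x → VS (F i) y → x ≢ y → PathAvoiding F i x y
  cactus-path-avoiding (base C C-cycle@(s≤s (s≤s (s≤s z≤n)) , _) F≐C) i x y x∈ y∈ x≢y
    with SingleCycle.VS-member⇒position C-cycle F≐C i x∈ | SingleCycle.VS-member⇒position C-cycle F≐C i y∈
  ... | s , refl | t , refl = path-avoiding i s t (x≢y ∘ cong w)
    where open SingleCycle C-cycle F≐C
  cactus-path-avoiding {F = F} (split {N₁ = N₁} {N₂ = N₂} σ c₁ c₂ (z , z₁ , z₂ , meet)) =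
    path-avoiding-⋃ (touching meet) z₁ z₂ classify VS-⋃-classify
      (cactus-path-avoiding c₁) (cactus-path-avoiding c₂)
    where open Split {F = F} {N₁ = N₁} {N₂ = N₂} σ

  cactus-even-path-avoiding : ∀ {N F} → PrunedCactus {A} N F → OddCycles F →
    ∀ i x y → VS (F i) y → ¬ VS (F i) x → VS (⋃ F) x → EvenPathAvoiding F i x y
  cactus-even-path-avoiding (base C C-cycle@(s≤s (s≤s (s≤s z≤n)) , _) F≐C) odd i x y y∈ x∉ x∈
    with SingleCycle.VS-⋃⇒position C-cycle F≐C x∈
  ... | s , refl = ⊥-elim (x∉ (SingleCycle.position⇒VS-member C-cycle F≐C i s))
  cactus-even-path-avoiding {F = F} (split {N₁ = N₁} {N₂ = N₂} σ c₁ c₂ (z , z₁ , z₂ , meet)) odd =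
    even-path-avoiding-⋃ (touching meet) z₁ z₂ classify VS-⋃-classify (odd ∘ index left) (odd ∘ index right)
      (cactus-even-path-avoiding c₁ (odd ∘ index left)) (cactus-even-path-avoiding c₂ (odd ∘ index right))
      (cactus-path-avoiding c₁) (cactus-path-avoiding c₂)
      (cactus-path-of-parity c₁ (odd ∘ index left)) (cactus-path-of-parity c₂ (odd ∘ index right))
    where open Split {F = F} {N₁ = N₁} {N₂ = N₂} σ

record Enumeration {A : Set} (P : A → Set) (K : ℕ) : Set where
  field
    elem     : Fin K → A
    elem-inj : Injective _≡_ _≡_ elem
    complete : ∀ x → P x → ∃[ j ] elem j ≡ x
    sound    : ∀ j → P (elem j)

Enumeration-cast : ∀ {A : Set} {P : A → Set} {K K'} → K ≡ K' → Enumeration P K → Enumeration P K'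
Enumeration-cast refl E = E

module _ {A : Set} {P Q : A → Set} where

  Enumeration-resp : (∀ x → P x → Q x) → (∀ x → Q x → P x) → ∀ {K} → Enumeration P K → Enumeration Q K
  Enumeration-resp P⇒Q Q⇒P E = record
    { elem = elem ; elem-inj = elem-inj ; complete = λ x → complete x ∘ Q⇒P x ; sound = P⇒Q _ ∘ sound }
    where open Enumeration E

  -- z is listed once: as a member of P, and punched out of the enumeration of Q
  Enumeration-⊎ : ∀ {K₁ K₂ z} → Enumeration P (suc K₁) → Enumeration Q (suc K₂) → P z → Q z →
                  (∀ v → P v → Q v → v ≡ z) → Enumeration (λ v → P v ⊎ Q v) (suc K₁ + K₂)
  Enumeration-⊎ {K₁} {K₂} {z} E₁ E₂ Pz Qz meet = record
    { elem = elem ; elem-inj = elem-inj ; complete = complete ; sound = sound }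
    where
    module E₁ = Enumeration E₁
    module E₂ = Enumeration E₂
    zpos : Fin (suc K₂)
    zpos = proj₁ (E₂.complete z Qz)
    E₂-zpos : E₂.elem zpos ≡ z
    E₂-zpos = proj₂ (E₂.complete z Qz)
    elem⊎ : Fin (suc K₁) ⊎ Fin K₂ → A
    elem⊎ (inj₁ j) = E₁.elem j
    elem⊎ (inj₂ j) = E₂.elem (Fin.punchIn zpos j)
    elem⊎-distinct : ∀ i j → E₁.elem i ≢ E₂.elem (Fin.punchIn zpos j)
    elem⊎-distinct i j eq = Finₚ.punchInᵢ≢i zpos j (E₂.elem-inj (begin
      E₂.elem (Fin.punchIn zpos j) ≡⟨ eq ⟨
      E₁.elem i                    ≡⟨ meet _ (E₁.sound i) (subst Q (sym eq) (E₂.sound _)) ⟩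
      z                            ≡⟨ E₂-zpos ⟨
      E₂.elem zpos                 ∎))
      where open ≡-Reasoning
    elem⊎-inj : Injective _≡_ _≡_ elem⊎
    elem⊎-inj {inj₁ i} {inj₁ j} eq = cong inj₁ (E₁.elem-inj eq)
    elem⊎-inj {inj₁ i} {inj₂ j} eq = ⊥-elim (elem⊎-distinct i j eq)
    elem⊎-inj {inj₂ i} {inj₁ j} eq = ⊥-elim (elem⊎-distinct j i (sym eq))
    elem⊎-inj {inj₂ i} {inj₂ j} eq = cong inj₂ (Finₚ.punchIn-injective zpos i j (E₂.elem-inj eq))
    elem : Fin (suc K₁ + K₂) → A
    elem = elem⊎ ∘ Fin.splitAt (suc K₁)
    elem-join : ∀ t → elem (Fin.join (suc K₁) K₂ t) ≡ elem⊎ t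
    elem-join t = cong elem⊎ (Finₚ.splitAt-join (suc K₁) K₂ t)
    elem-inj : Injective _≡_ _≡_ elem
    elem-inj {i} {j} eq = begin
      i                                                      ≡⟨ Finₚ.join-splitAt (suc K₁) K₂ i ⟨
      Fin.join (suc K₁) K₂ (Fin.splitAt (suc K₁) i)          ≡⟨ cong (Fin.join (suc K₁) K₂) (elem⊎-inj {Fin.splitAt (suc K₁) i} {Fin.splitAt (suc K₁) j} eq) ⟩
      Fin.join (suc K₁) K₂ (Fin.splitAt (suc K₁) j)          ≡⟨ Finₚ.join-splitAt (suc K₁) K₂ j ⟩
      j                                                      ∎
      where open ≡-Reasoning
    complete₁ : ∀ x → P x → ∃[ j ] elem j ≡ x
    complete₁ x Px = let (j , eq) = E₁.complete x Px in Fin.join (suc K₁) K₂ (inj₁ j) , trans (elem-join (inj₁ j)) eq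
    complete : ∀ x → P x ⊎ Q x → ∃[ j ] elem j ≡ x
    complete x (inj₁ Px) = complete₁ x Px
    complete x (inj₂ Qx) with E₂.complete x Qx
    ... | j , eq with zpos Finₚ.≟ j
    ... | yes refl = complete₁ x (subst P (trans (sym E₂-zpos) eq) Pz)
    ... | no zpos≢j = Fin.join (suc K₁) K₂ (inj₂ (Fin.punchOut zpos≢j)) ,
                      trans (elem-join (inj₂ _)) (trans (cong E₂.elem (Finₚ.punchIn-punchOut zpos≢j)) eq)
    sound : ∀ j → P (elem j) ⊎ Q (elem j)
    sound j with Fin.splitAt (suc K₁) j
    ... | inj₁ i = inj₁ (E₁.sound i)
    ... | inj₂ i = inj₂ (E₂.sound _)

cactus-vertices : ∀ {A : Set} {N F} → PrunedCactus {A} N F → Enumeration (VS (⋃ F)) (suc N)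
cactus-vertices (base C C-cycle@(s≤s (s≤s (s≤s z≤n)) , _) F≐C) = record
  { elem = w ; elem-inj = proj₁ (proj₂ (proj₂ C-cycle))
  ; complete = λ _ → VS-⋃⇒position ; sound = position⇒VS-⋃ }
  where open SingleCycle C-cycle F≐C
cactus-vertices {F = F} (split {N₁ = N₁} {N₂ = N₂} σ c₁ c₂ (z , z₁ , z₂ , meet)) =
  Enumeration-cast (cong suc (↔⇒≡ σ))
    (Enumeration-resp (λ _ → [ VS-⋃-members⇒VS-⋃ left , VS-⋃-members⇒VS-⋃ right ]′) (λ _ → VS-⋃-classify)
      (Enumeration-⊎ (cactus-vertices c₁) (cactus-vertices c₂) z₁ z₂ meet))
  where open Split {F = F} {N₁ = N₁} {N₂ = N₂} σ

module ContractionProperties {M : ℕ} (S : Fin M → Set) where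
  open Contraction S

  Img-valid : ∀ {u x} → Img u x → ValidV x
  Img-valid (inj₁ (_ , refl))  = tt
  Img-valid (inj₂ (u∉ , refl)) = u∉

  πE-valid : ∀ {E x y} → Adj (πE E) x y → ValidV x × ValidV y
  πE-valid (_ , inj₁ (_ , _ , _ , _ , ux , vy)) = Img-valid ux , Img-valid vy
  πE-valid (_ , inj₂ (_ , _ , _ , _ , uy , vx)) = Img-valid vx , Img-valid uy

  πE-just : ∀ {E x y} → Adj (πE E) (just x) (just y) → Adj E x y
  πE-just (_ , inj₁ (_ , _ , uv , _ , inj₂ (_ , refl) , inj₂ (_ , refl))) = uv
  πE-just {E} (_ , inj₂ (_ , _ , uv , _ , inj₂ (_ , refl) , inj₂ (_ , refl))) = Adj-sym {E = E} uv
  πE-just (_ , inj₁ (_ , _ , _ , _ , inj₁ (_ , ()) , _))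
  πE-just (_ , inj₁ (_ , _ , _ , _ , inj₂ _ , inj₁ (_ , ())))
  πE-just (_ , inj₂ (_ , _ , _ , _ , inj₁ (_ , ()) , _))
  πE-just (_ , inj₂ (_ , _ , _ , _ , inj₂ _ , inj₁ (_ , ())))

  πE-nothing : ∀ {E x} → Adj (πE E) nothing (just x) → ∃[ u ] (S u × Adj E u x)
  πE-nothing (_ , inj₁ (u , _ , ux , _ , inj₁ (Su , _) , inj₂ (_ , refl))) = u , Su , ux
  πE-nothing {E} (_ , inj₂ (_ , v , xv , _ , inj₂ (_ , refl) , inj₁ (Sv , _))) = v , Sv , Adj-sym {E = E} xv
  πE-nothing (_ , inj₁ (_ , _ , _ , _ , inj₂ (_ , ()) , _))
  πE-nothing (_ , inj₁ (_ , _ , _ , _ , inj₁ _ , inj₁ (_ , ())))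
  πE-nothing (_ , inj₂ (_ , _ , _ , _ , inj₁ (_ , ()) , _))
  πE-nothing (_ , inj₂ (_ , _ , _ , _ , inj₂ _ , inj₂ (_ , ())))

  VS-πE-just : ∀ {E u} → VS (πE E) (just u) → VS E u
  VS-πE-just (_ , _ , inj₁ (_ , v , uv , _ , inj₂ (_ , refl) , _)) = v , uv
  VS-πE-just {E} (_ , _ , inj₂ (v , _ , vu , _ , _ , inj₂ (_ , refl))) = v , Adj-sym {E = E} vu
  VS-πE-just (_ , _ , inj₁ (_ , _ , _ , _ , inj₁ (_ , ()) , _))
  VS-πE-just (_ , _ , inj₂ (_ , _ , _ , _ , _ , inj₁ (_ , ())))

  VS-⋃-πE-valid : ∀ {N} {F : Fin N → EdgeSet (Fin M)} {x} → VS (⋃ (πE ∘ F)) x → ValidV x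
  VS-⋃-πE-valid {F = F} (_ , xy) = proj₁ (πE-valid (proj₂ (Adj-⋃⇒Adj {F = πE ∘ F} xy)))

  πE-mono : ∀ {E E'} → E ⊆E E' → πE E ⊆E πE E'
  πE-mono E⊆E' _ _ (x≢y , inj₁ (u , v , uv , ¬SS , ux , vy)) = x≢y , inj₁ (u , v , E⊆E' u v uv , ¬SS , ux , vy)
  πE-mono E⊆E' _ _ (x≢y , inj₂ (u , v , uv , ¬SS , uy , vx)) = x≢y , inj₂ (u , v , E⊆E' u v uv , ¬SS , uy , vx)

  πE-edge-nothing : ∀ {E u v} → Adj E u v → S u → ¬ S v → Adj (πE E) nothing (just v)
  πE-edge-nothing uv Su v∉ = (λ ()) , inj₁ (_ , _ , uv , v∉ ∘ proj₂ , inj₁ (Su , refl) , inj₂ (v∉ , refl))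

just-of : ∀ {A : Set} (x : Maybe A) → x ≢ nothing → ∃[ u ] x ≡ just u
just-of (just u) _   = u , refl
just-of nothing  x≢n = ⊥-elim (x≢n refl)

Enumeration-dec : ∀ {A : Set} {P : A → Set} {K} → DecidableEquality A → Enumeration P K → ∀ x → Dec (P x)
Enumeration-dec _≟_ E x with Finₚ.any? (λ j → elem j ≟ x)
  where open Enumeration E
... | yes (j , refl) = yes (Enumeration.sound E j)
... | no ¬∃j         = no (¬∃j ∘ Enumeration.complete E x)

Adj-Complete : ∀ {A : Set} {x y : A} → x ≢ y → Adj (Complete A) x y
Adj-Complete x≢y = x≢y , inj₁ tt

module Lemma {k m : ℕ}
  (O : Fin (k + suc m) → EdgeSet (Fin (suc (k + suc m))))
  (no-rainbow-odd-cycle : ¬ RainbowOddCycleIn (Complete (Fin (suc (k + suc m)))) O)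
  (Q : EdgeSet (Fin (suc (k + suc m)))) (Q-vertices : Enumeration (VS Q) (suc k))
  (V : Fin (suc (k + suc m)) → Set) (V⊆Q : ∀ u → V u → VS Q u)
  (even-paths : ∀ a b → V a → V b → a ≢ b →
     ∃[ P ] ∃[ L ] (IsPath P a b L × Even L × P ⊆E Q × Rainbow (λ (i : Fin k) → O (i ↑ˡ suc m)) P))
  where

  n : ℕ
  n = k + suc m

  X : Set
  X = Fin (suc n)

  K : Fin k → EdgeSet X
  K i = O (i ↑ˡ suc m)

  S : X → Set
  S = VS Q

  open Contraction S
  open ContractionProperties S

  record EvenKPath (a b : X) : Set where
    field
      path       : RainbowPath O a b
      even       : Even (length (walk path))
      inside-Q   : ∀ x → x ∈ᵥ walk path → S x
      K-coloured : ∀ c → c ∈ᶜ walk path → ∃[ c' ] c' ↑ˡ suc m ≡ c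

    avoids : ∀ j → ¬ ((k ↑ʳ j) ∈ᶜ walk path)
    avoids j c∈ = let (c' , eq) = K-coloured _ c∈ in ↑ˡ≢↑ʳ c' j eq

  evenKPath : ∀ {a b} → V a → V b → EvenKPath a b
  evenKPath {a} {b} a∈V b∈V with a Finₚ.≟ b
  ... | yes refl = record
    { path = record { walk = [] ; simple = tt ; rainbow = tt } ; even = 0 , refl
    ; inside-Q = λ { _ refl → V⊆Q a a∈V } ; K-coloured = λ _ () }
  ... | no a≢b with even-paths a b a∈V b∈V a≢b
  ... | P , L , P-path , even-L , P⊆Q , P-rainbow with IsPath⇒Walk {F = K} P-path P-rainbow
  ... | p , simple-p , rainbow-p , length-p , on-P = record
    { path       = record { walk    = reindex (_↑ˡ suc m) (λ _ e → e) p
                          ; simple  = IsSimple-reindex _ _ p simple-p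
                          ; rainbow = IsRainbow-reindex _ _ (Finₚ.↑ˡ-injective (suc m) _ _) p rainbow-p }
    ; even       = subst Even (sym (trans (length-reindex _ _ p) length-p)) even-L
    ; inside-Q   = λ x x∈ → [ (λ (y , xy) → y , P⊆Q _ _ xy) , (λ { refl → V⊆Q b b∈V }) ]′
                              (on-P x (∈ᵥ-reindex⁻ _ _ p x∈))
    ; K-coloured = λ c c∈ → let (c' , _ , eq) = ∈ᶜ-reindex⁻ _ _ p c∈ in c' , eq }

  no-edge-within-V : ∀ j a b → V a → V b → ¬ Adj (O (k ↑ʳ j)) a b
  no-edge-within-V j a b a∈V b∈V ab = no-rainbow-odd-cycle
    (closeToRainbowOddCycle (walk path) (simple path) (rainbow path) (k ↑ʳ j) (avoids j)
      (Adj-sym {E = O (k ↑ʳ j)} ab) (Even⇒≢0⇒≥2 even (proj₁ ab ∘ length≡0⇒≡ (walk path)))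
      (Even⇒Odd-suc even) (λ _ _ _ _ → Adj-Complete))
    where open EvenKPath (evenKPath a∈V b∈V)

  -- π(K_{n+1}) has (n + 1) - (k + 1) + 1 = m + 2 vertices: v̄ and those outside V(Q)
  valid-injection-≤ : ∀ {L} (ys : Fin L → Maybe X) → Injective _≡_ _≡_ ys → (∀ j → ValidV (ys j)) →
                      L ≤ suc (suc m)
  valid-injection-≤ {L} ys ys-inj ys-valid = ℕₚ.+-cancelˡ-≤ k L (suc (suc m))
    (subst (k + L ≤_) (sym (ℕₚ.+-suc k (suc m))) (Finₚ.injective⇒≤ G-inj))
    where
    open Enumeration Q-vertices
    embed : Maybe X → X
    embed nothing  = elem zero
    embed (just u) = u
    embed-inj : ∀ x y → ValidV x → ValidV y → embed x ≡ embed y → x ≡ y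
    embed-inj nothing  nothing  _   _   _  = refl
    embed-inj nothing  (just u) _   u∉Q eq = ⊥-elim (u∉Q (subst S eq (sound zero)))
    embed-inj (just u) nothing  u∉Q _   eq = ⊥-elim (u∉Q (subst S (sym eq) (sound zero)))
    embed-inj (just u) (just _) _   _   eq = cong just eq
    embed≢elem : ∀ i x → ValidV x → elem (suc i) ≢ embed x
    embed≢elem i nothing  _   eq = Finₚ.0≢1+n (sym (elem-inj eq))
    embed≢elem i (just u) u∉Q eq = u∉Q (subst S eq (sound (suc i)))
    g : Fin k ⊎ Fin L → X
    g (inj₁ i) = elem (suc i)
    g (inj₂ j) = embed (ys j)
    g-inj : Injective _≡_ _≡_ g
    g-inj {inj₁ i} {inj₁ j} eq = cong inj₁ (Finₚ.suc-injective (elem-inj eq))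
    g-inj {inj₁ i} {inj₂ j} eq = ⊥-elim (embed≢elem i (ys j) (ys-valid j) eq)
    g-inj {inj₂ i} {inj₁ j} eq = ⊥-elim (embed≢elem j (ys i) (ys-valid i) (sym eq))
    g-inj {inj₂ i} {inj₂ j} eq = cong inj₂ (ys-inj (embed-inj _ _ (ys-valid i) (ys-valid j) eq))
    G-inj : Injective _≡_ _≡_ (g ∘ Fin.splitAt k)
    G-inj {a} {b} eq = begin
      a                                 ≡⟨ Finₚ.join-splitAt k L a ⟨
      Fin.join k L (Fin.splitAt k a)    ≡⟨ cong (Fin.join k L) (g-inj {Fin.splitAt k a} {Fin.splitAt k b} eq) ⟩
      Fin.join k L (Fin.splitAt k b)    ≡⟨ Finₚ.join-splitAt k L b ⟩
      b                                 ∎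
      where open ≡-Reasoning

  maximal-valid-injection-complete : (ys : Fin (suc (suc m)) → Maybe X) → Injective _≡_ _≡_ ys →
    (∀ j → ValidV (ys j)) → ∀ x → ValidV x → ∃[ j ] ys j ≡ x
  maximal-valid-injection-complete ys ys-inj ys-valid x x-valid with Finₚ.any? (λ j → ys j ≟ x)
    where _≟_ = Maybeₚ.≡-dec Finₚ._≟_
  ... | yes found = found
  ... | no ¬found = ⊥-elim (ℕₚ.1+n≰n (valid-injection-≤ x∷ys x∷ys-inj x∷ys-valid))
    where
    x∷ys : Fin (suc (suc (suc m))) → Maybe X
    x∷ys zero    = x
    x∷ys (suc j) = ys j
    x∷ys-inj : Injective _≡_ _≡_ x∷ys
    x∷ys-inj {zero}  {zero}  _  = refl
    x∷ys-inj {zero}  {suc j} eq = ⊥-elim (¬found (j , sym eq))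
    x∷ys-inj {suc i} {zero}  eq = ⊥-elim (¬found (i , eq))
    x∷ys-inj {suc i} {suc j} eq = cong suc (ys-inj eq)
    x∷ys-valid : ∀ j → ValidV (x∷ys j)
    x∷ys-valid zero    = x-valid
    x∷ys-valid (suc j) = ys-valid j

  module Projection (P : Fin (suc m) → EdgeSet X) (P⊆O : ∀ j → P j ⊆E O (k ↑ʳ j))
                    (P∩Q⊆V : ∀ j u → VS (P j) u → S u → V u) where

    P̄ : Fin (suc m) → EdgeSet (Maybe X)
    P̄ j = πE (P j)

    lift-edge : ∀ {c x y} → Adj (P̄ c) (just x) (just y) → Adj (O (k ↑ʳ c)) x y
    lift-edge {c} = P⊆O c _ _ ∘ πE-just

    cycle-avoiding-v̄ : ∀ {M} (D : ColouredCycle P̄ M) → Injective _≡_ _≡_ (ColouredCycle.colour D) →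
                       2 ≤ M → Odd (suc M) → (∀ i → ColouredCycle.vertex D i ≢ nothing) → ⊥
    cycle-avoiding-v̄ {M} D colour-inj 2≤M odd v̄∉ =
      no-rainbow-odd-cycle (ColouredCycle⇒RainbowOddCycle lifted (colour-inj ∘ Finₚ.↑ʳ-injective k _ _)
                             2≤M odd (λ _ _ → Adj-Complete))
      where
      open ColouredCycle D
      below : ∀ i → ∃[ x ] vertex i ≡ just x
      below i = just-of (vertex i) (v̄∉ i)
      lifted : ColouredCycle O M
      lifted = record
        { vertex     = proj₁ ∘ below
        ; colour     = (k ↑ʳ_) ∘ colour
        ; vertex-inj = λ {i} {j} eq → vertex-inj (trans (proj₂ (below i)) (trans (cong just eq) (sym (proj₂ (below j)))))
        ; edge       = λ i → lift-edge (subst₂ (Adj (P̄ (colour i))) (proj₂ (below i)) (proj₂ (below (csuc i))) (edge i)) }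

    -- the cycle enters and leaves v̄ through vertices u₀, u₁ ∈ V, joined in Q by an even path
    module ThroughV̄ {M₀ : ℕ} (D : ColouredCycle P̄ (2 + M₀)) (colour-inj : Injective _≡_ _≡_ (ColouredCycle.colour D))
                    (valid : ∀ i → ValidV (ColouredCycle.vertex D i)) (odd : Odd (3 + M₀))
                    (v̄-first : ColouredCycle.vertex D zero ≡ nothing) where
      open ColouredCycle D

      M₁ : ℕ
      M₁ = suc M₀

      inner-position : Fin (suc M₁) → Fin (suc (suc M₁))
      inner-position = shift 1 M₁ ℕₚ.≤-refl

      toℕ-inner-position : ∀ j → toℕ (inner-position j) ≡ suc (toℕ j)
      toℕ-inner-position = toℕ-shift 1 M₁ ℕₚ.≤-refl

      inner-vertex : ∀ j → ∃[ x ] vertex (inner-position j) ≡ just x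
      inner-vertex j = just-of _ λ v̄≡ → ℕₚ.0≢1+n (trans (cong toℕ (vertex-inj (trans v̄-first (sym v̄≡))))
                                                        (toℕ-inner-position j))

      W : Fin (suc M₁) → X
      W = proj₁ ∘ inner-vertex

      inner-colour : Fin M₁ → Fin n
      inner-colour j = k ↑ʳ colour (inner-position (inject₁ j))

      inner-edge : ∀ j → Adj (O (inner-colour j)) (W (inject₁ j)) (W (suc j))
      inner-edge j = lift-edge (subst₂ (Adj (P̄ (colour (inner-position (inject₁ j)))))
        (proj₂ (inner-vertex (inject₁ j)))
        (trans (cong vertex (csuc-shift 1 M₁ ℕₚ.≤-refl j)) (proj₂ (inner-vertex (suc j))))
        (edge (inner-position (inject₁ j))))

      x₁ y₁ : X
      x₁ = W zero
      y₁ = W (fromℕ M₁)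

      inner : Walk O x₁ y₁
      inner = walkAlong W inner-colour inner-edge refl refl

      inner-simple : IsSimple inner
      inner-simple = IsSimple-walkAlong W inner-colour inner-edge refl refl λ {i} {j} eq →
        shift-injective 1 M₁ ℕₚ.≤-refl (vertex-inj (trans (proj₂ (inner-vertex i))
          (trans (cong just eq) (sym (proj₂ (inner-vertex j))))))

      inner-rainbow : IsRainbow inner
      inner-rainbow = IsRainbow-walkAlong W inner-colour inner-edge refl refl
        (Finₚ.inject₁-injective ∘ shift-injective 1 M₁ ℕₚ.≤-refl ∘ colour-inj ∘ Finₚ.↑ʳ-injective k _ _)

      length-inner : length inner ≡ M₁
      length-inner = length-walkAlong W inner-colour inner-edge refl refl

      inner-outside-Q : ∀ x → x ∈ᵥ inner → ¬ S x
      inner-outside-Q x x∈ with ∈ᵥ-walkAlong⁻ W inner-colour inner-edge refl refl x∈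
      ... | j , refl = subst ValidV (proj₂ (inner-vertex j)) (valid (inner-position j))

      -- the inner edges are those at positions 1, …, M₁ of the cycle, which excludes
      -- position 0 (entering v̄) and position M₁ + 1 (leaving v̄)
      inner-colours : ∀ c → c ∈ᶜ inner → ∃[ i ] (c ≡ k ↑ʳ colour i × 1 ≤ toℕ i × toℕ i ≤ M₁)
      inner-colours c c∈ with ∈ᶜ-walkAlong⁻ W inner-colour inner-edge refl refl c∈
      ... | j , refl = inner-position (inject₁ j) , refl ,
        subst (1 ≤_) (sym (toℕ-inner-position (inject₁ j))) (s≤s z≤n) ,
        subst (_≤ M₁) (sym (toℕ-inner-position (inject₁ j)))
              (subst (_< M₁) (sym (Finₚ.toℕ-inject₁ j)) (Finₚ.toℕ<n j))

      c₀ cₗ : Fin (suc m)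
      c₀ = colour zero
      cₗ = colour (fromℕ (suc M₁))

      c₀≢cₗ : k ↑ʳ c₀ ≢ k ↑ʳ cₗ
      c₀≢cₗ eq = ℕₚ.0≢1+n (trans (cong toℕ (colour-inj (Finₚ.↑ʳ-injective k _ _ eq))) (Finₚ.toℕ-fromℕ _))

      entering : Adj (P̄ c₀) nothing (just x₁)
      entering = subst₂ (Adj (P̄ c₀)) v̄-first (trans (cong vertex second) (proj₂ (inner-vertex zero))) (edge zero)
        where
        second : csuc zero ≡ inner-position zero
        second = trans (csuc-inject₁ zero) (Finₚ.toℕ-injective (sym (toℕ-inner-position zero)))

      leaving : Adj (P̄ cₗ) nothing (just y₁)
      leaving = Adj-sym {E = P̄ cₗ} (subst₂ (Adj (P̄ cₗ))
        (trans (cong vertex (sym at-last)) (proj₂ (inner-vertex (fromℕ M₁))))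
        (trans (cong vertex (csuc-fromℕ _)) v̄-first) (edge (fromℕ (suc M₁))))
        where
        at-last : inner-position (fromℕ M₁) ≡ fromℕ (suc M₁)
        at-last = Finₚ.toℕ-injective (trans (toℕ-inner-position (fromℕ M₁))
                                         (trans (cong suc (Finₚ.toℕ-fromℕ M₁)) (sym (Finₚ.toℕ-fromℕ _))))

      u₀ u₁ : X
      u₀ = proj₁ (πE-nothing entering)
      u₁ = proj₁ (πE-nothing leaving)

      u₀x₁ : Adj (P c₀) u₀ x₁
      u₀x₁ = proj₂ (proj₂ (πE-nothing entering))

      u₁y₁ : Adj (P cₗ) u₁ y₁
      u₁y₁ = proj₂ (proj₂ (πE-nothing leaving))

      back : EvenKPath u₁ u₀
      back = evenKPath (P∩Q⊆V cₗ u₁ (_ , u₁y₁) (proj₁ (proj₂ (πE-nothing leaving))))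
                       (P∩Q⊆V c₀ u₀ (_ , u₀x₁) (proj₁ (proj₂ (πE-nothing entering))))
      open EvenKPath back

      tail : Walk O y₁ u₀
      tail = step (k ↑ʳ cₗ) (P⊆O cₗ _ _ (Adj-sym {E = P cₗ} u₁y₁)) (walk path)

      cycle-walk : Walk O x₁ u₀
      cycle-walk = inner ++ʷ tail

      cycle-walk-simple : IsSimple cycle-walk
      cycle-walk-simple = IsSimple-++ inner tail inner-simple (y₁∉back , simple path) meet
        where
        y₁∉back : ¬ (y₁ ∈ᵥ walk path)
        y₁∉back y₁∈ = inner-outside-Q y₁ (end∈ᵥ inner) (inside-Q y₁ y₁∈)
        meet : ∀ v → v ∈ᵥ inner → v ∈ᵥ tail → v ≡ y₁
        meet v _    (inj₁ v≡)   = v≡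
        meet v v∈ (inj₂ v∈back) = ⊥-elim (inner-outside-Q v v∈ (inside-Q v v∈back))

      cycle-walk-rainbow : IsRainbow cycle-walk
      cycle-walk-rainbow = IsRainbow-++ inner tail inner-rainbow (avoids cₗ , rainbow path) disjoint
        where
        disjoint : ∀ c → c ∈ᶜ inner → c ∈ᶜ tail → ⊥
        disjoint c c∈ c∈tail with inner-colours c c∈
        disjoint c c∈ (inj₁ refl)   | i , eq , _ , i≤M₁ = ℕₚ.1+n≰n (subst (_≤ M₁)
          (trans (cong toℕ (sym (colour-inj (Finₚ.↑ʳ-injective k _ _ eq)))) (Finₚ.toℕ-fromℕ _)) i≤M₁)
        disjoint c c∈ (inj₂ c∈back) | i , refl , _ = avoids (colour i) c∈back

      c₀∉cycle-walk : ¬ ((k ↑ʳ c₀) ∈ᶜ cycle-walk)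
      c₀∉cycle-walk c₀∈ with ∈ᶜ-++⁻ inner tail c₀∈
      ... | inj₂ (inj₁ eq)    = c₀≢cₗ eq
      ... | inj₂ (inj₂ c₀∈back) = avoids c₀ c₀∈back
      ... | inj₁ c₀∈inner with inner-colours _ c₀∈inner
      ... | i , eq , 1≤i , _ with colour-inj (Finₚ.↑ʳ-injective k _ _ eq)
      ... | refl with () ← 1≤i

      length-cycle-walk : length cycle-walk ≡ M₁ + suc (length (walk path))
      length-cycle-walk = trans (length-++ inner tail) (cong (_+ suc (length (walk path))) length-inner)

      contradiction : ⊥
      contradiction = no-rainbow-odd-cycle (closeToRainbowOddCycle cycle-walk cycle-walk-simple
        cycle-walk-rainbow (k ↑ʳ c₀) c₀∉cycle-walk (P⊆O c₀ _ _ u₀x₁)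
        (subst (2 ≤_) (sym length-cycle-walk) (s≤s (ℕₚ.≤-trans (s≤s z≤n) (ℕₚ.m≤n+m (suc (length (walk path))) M₀))))
        (subst (Odd ∘ suc) (sym length-cycle-walk)
          (subst Odd (sym (cong suc (ℕₚ.+-suc M₁ _))) (Odd-+-Even odd even)))
        (λ _ _ _ _ → Adj-Complete))

    no-contracted-rainbow-odd-cycle : ¬ RainbowOddCycleIn πK P̄
    no-contracted-rainbow-odd-cycle (C , zero , (() , _) , _)
    no-contracted-rainbow-odd-cycle (C , suc zero , (s≤s () , _) , _)
    no-contracted-rainbow-odd-cycle (C , suc (suc zero) , (s≤s (s≤s ()) , _) , _)
    no-contracted-rainbow-odd-cycle (C , suc (suc (suc M₀)) , C-cycle , odd , C⊆πK , C-rainbow)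
      with IsCycle⇒ColouredCycle C-cycle C-rainbow
    ... | D , colour-inj , on-C with Finₚ.any? (λ i → vertex i ≟ nothing)
      where
      open ColouredCycle D
      _≟_ = Maybeₚ.≡-dec Finₚ._≟_
    ... | no v̄∉ = cycle-avoiding-v̄ D colour-inj (s≤s (s≤s z≤n)) odd (λ i eq → v̄∉ (i , eq))
    ... | yes (s , v̄-at-s) = ThroughV̄.contradiction (rotate D (toℕ s))
      (csuc^-injective (toℕ s) ∘ colour-inj) (valid ∘ csuc^ (toℕ s)) odd
      (trans (cong (ColouredCycle.vertex D) (csuc^-toℕ-zero s)) v̄-at-s)
      where
      valid : ∀ i → ValidV (ColouredCycle.vertex D i)
      valid i with C⊆πK _ _ (on-C i)
      ... | _ , inj₁ (valid-i , _) = valid-i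
      ... | _ , inj₂ (_ , valid-i) = valid-i

  spanning : ∀ {P} → PrunedCactus (suc m) (πE ∘ P) → ∀ x → ValidV x → VS (⋃ (πE ∘ P)) x
  spanning {P} cactus x x-valid =
    let (j , eq) = maximal-valid-injection-complete elem elem-inj (VS-⋃-πE-valid {F = P} ∘ sound) x x-valid
    in subst (VS (⋃ (πE ∘ P))) eq (sound j)
    where open Enumeration (cactus-vertices cactus)

  module AddEdge (P : Fin (suc m) → EdgeSet X) (j : Fin (suc m)) (u v : X) where

    P⁺ : Fin (suc m) → EdgeSet X
    P⁺ j' a b = P j' a b ⊎ (j' ≡ j × SameEdge u v a b)

    Adj-P⁺ : ∀ {j' a b} → Adj (P⁺ j') a b → Adj (P j') a b ⊎ (j' ≡ j × SameEdge u v a b)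
    Adj-P⁺ (a≢b , inj₁ (inj₁ ab))           = inj₁ (a≢b , inj₁ ab)
    Adj-P⁺ (a≢b , inj₂ (inj₁ ba))           = inj₁ (a≢b , inj₂ ba)
    Adj-P⁺ (_   , inj₁ (inj₂ new))          = inj₂ new
    Adj-P⁺ (_   , inj₂ (inj₂ (refl , new))) = inj₂ (refl , SameEdge-flipʳ new)

    P⊆P⁺ : ∀ j' → P j' ⊆E P⁺ j'
    P⊆P⁺ j' a b (a≢b , inj₁ ab) = a≢b , inj₁ (inj₁ ab)
    P⊆P⁺ j' a b (a≢b , inj₂ ba) = a≢b , inj₂ (inj₁ ba)

    vu∈P⁺ : u ≢ v → Adj (P⁺ j) v u
    vu∈P⁺ u≢v = u≢v ∘ sym , inj₂ (inj₂ (refl , inj₁ (refl , refl)))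

  S? : ∀ x → Dec (S x)
  S? = Enumeration-dec Finₚ._≟_ Q-vertices

  no-escaping-edge : ∀ P → (∀ j → P j ⊆E O (k ↑ʳ j)) → (∀ j u → VS (P j) u → S u → V u) →
    OddCycles (πE ∘ P) → PrunedCactus (suc m) (πE ∘ P) →
    ∀ j u v → Adj (O (k ↑ʳ j) ∖E P j) u v → ¬ S u → ¬ VS (P j) u → V v → VS (P j) v → ⊥
  no-escaping-edge P P⊆O P∩Q⊆V odd cactus j u v (u≢v , uv∉P) u∉Q u∉Pj v∈V (t , vt) =
    Projection.no-contracted-rainbow-odd-cycle P⁺ P⁺⊆O P⁺∩Q⊆V
      (closeToRainbowOddCycle p⁺ (IsSimple-reindex _ _ (walk p) (simple p))
        (IsRainbow-reindex _ _ (λ eq → eq) (walk p) (rainbow p)) j j∉p⁺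
        (πE-edge-nothing (vu∈P⁺ u≢v) (V⊆Q v v∈V) u∉Q)
        (subst (2 ≤_) (sym length-p⁺) (Even⇒≢0⇒≥2 even-p (just≢nothing ∘ length≡0⇒≡ (walk p))))
        (subst (Odd ∘ suc) (sym length-p⁺) (Even⇒Odd-suc even-p))
        (λ x y x∈ y∈ x≢y → x≢y , inj₁ (on-p x∈ , on-p y∈)))
    where
    open AddEdge P j u v
    just≢nothing : just u ≢ nothing
    just≢nothing ()
    uv∈O : Adj (O (k ↑ʳ j)) u v
    uv∈O = [ proj₁ , Adj-sym {E = O (k ↑ʳ j)} ∘ proj₁ ]′ uv∉P
    P⁺⊆O : ∀ j' → P⁺ j' ⊆E O (k ↑ʳ j')
    P⁺⊆O j' a b ab with Adj-P⁺ ab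
    ... | inj₁ ab∈P          = P⊆O j' a b ab∈P
    ... | inj₂ (refl , same) = Adj-resp-SameEdge {E = O (k ↑ʳ j)} same uv∈O
    P⁺∩Q⊆V : ∀ j' w → VS (P⁺ j') w → S w → V w
    P⁺∩Q⊆V j' w (y , wy) w∈Q with Adj-P⁺ wy
    ... | inj₁ wy∈P                   = P∩Q⊆V j' w (y , wy∈P) w∈Q
    ... | inj₂ (_ , inj₁ (refl , _))  = ⊥-elim (u∉Q w∈Q)
    ... | inj₂ (_ , inj₂ (_ , refl))  = v∈V
    -- the neighbour t of v in P j lies outside Q, by (a)
    v̄∈P̄j : VS (πE (P j)) nothing
    v̄∈P̄j with S? t
    ... | yes t∈Q = ⊥-elim (no-edge-within-V j v t v∈V (P∩Q⊆V j t (v , Adj-sym {E = P j} vt) t∈Q) (P⊆O j v t vt))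
    ... | no  t∉Q = just t , πE-edge-nothing vt (V⊆Q v v∈V) t∉Q
    even-path = CactusPaths.cactus-even-path-avoiding (Maybeₚ.≡-dec Finₚ._≟_) cactus odd j (just u) nothing
                  v̄∈P̄j (u∉Pj ∘ VS-πE-just) (spanning cactus (just u) u∉Q)
    p = proj₁ even-path
    even-p : Even (length (walk p))
    even-p = isEven⇒Even _ (proj₂ (proj₂ even-path))
    p⁺ : Walk (πE ∘ P⁺) (just u) nothing
    p⁺ = reindex (λ c → c) (λ c → πE-mono (P⊆P⁺ c) _ _) (walk p)
    length-p⁺ : length p⁺ ≡ length (walk p)
    length-p⁺ = length-reindex _ _ (walk p)
    j∉p⁺ : ¬ (j ∈ᶜ p⁺)
    j∉p⁺ j∈ with ∈ᶜ-reindex⁻ _ _ (walk p) j∈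
    ... | _ , j∈p , refl = proj₁ (proj₂ even-path) j∈p
    on-p : ∀ {x} → x ∈ᵥ p⁺ → ValidV x
    on-p x∈ = VS-⋃-πE-valid (∈ᵥ-nonempty⇒VS-⋃ (walk p) (λ ()) (∈ᵥ-reindex⁻ _ _ (walk p) x∈))

lemma2p4 : (k m : ℕ) →
  let n = k + suc m in
  (O : Fin n → EdgeSet (Fin (suc n))) →
  (∀ i → ∃[ L ] (IsCycle (O i) L × Odd L)) →
  ¬ RainbowOddCycleIn (Complete (Fin (suc n))) O →
  let K = λ (i : Fin k) → O (i ↑ˡ suc m) in
  (Q : EdgeSet (Fin (suc n))) → Q ⊆E ⋃ K →
  (Σ (Fin (suc k) → Fin (suc n)) λ f →
    Injective _≡_ _≡_ f × (∀ u → VS Q u ⇔ (∃[ j ] f j ≡ u))) →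
  (V : Fin (suc n) → Set) → (∀ u → V u → VS Q u) →
  (∀ a b → V a → V b → a ≢ b →
    ∃[ P ] ∃[ L ] (IsPath P a b L × Even L × P ⊆E Q × Rainbow K P)) →
  -- (a)
  (∀ (j : Fin (suc m)) a b → V a → V b → ¬ Adj (O (k ↑ʳ j)) a b)
  ×
  ((P : Fin (suc m) → EdgeSet (Fin (suc n))) →
   (∀ j → P j ⊆E O (k ↑ʳ j)) →
   (∀ j u → VS (P j) u → VS Q u → V u) →
   let Pbar = λ (j : Fin (suc m)) → Contraction.πE (VS Q) (P j) in
   -- (b)
   ¬ RainbowOddCycleIn (Contraction.πK (VS Q)) Pbar
   ×
   -- (c)
   ((∀ j → ∃[ L ] (IsCycle (Pbar j) L × Odd L)) → PrunedCactus (suc m) Pbar →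
     (∀ (x : Maybe (Fin (suc n))) → Contraction.ValidV (VS Q) x → VS (⋃ Pbar) x)
     ×
     (∀ j u v → Adj (O (k ↑ʳ j) ∖E P j) u v → ¬ VS Q u → ¬ VS (P j) u →
       V v → VS (P j) v → ⊥)))
lemma2p4 k m O _ no-rainbow-odd-cycle Q _ (f , f-inj , Q⇔f) V V⊆Q even-paths =
  no-edge-within-V ,
  λ P P⊆O P∩Q⊆V → Projection.no-contracted-rainbow-odd-cycle P P⊆O P∩Q⊆V ,
    λ odd cactus → spanning cactus , no-escaping-edge P P⊆O P∩Q⊆V odd cactus
  where
  Q-vertices : Enumeration (VS Q) (suc k)
  Q-vertices = record
    { elem = f ; elem-inj = f-inj
    ; complete = λ u → Equivalence.to (Q⇔f u) ; sound = λ j → Equivalence.from (Q⇔f (f j)) (j , refl) }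
  open Lemma O no-rainbow-odd-cycle Q Q-vertices V V⊆Q even-paths
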